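{- For all $n$, \[ \sum_{\pi\in\mathbb{S}_n} u^{\mathrm{DES}(\pi)}v^{\mathrm{ides}(\pi)} = \sum_{e\in\mathbb{I}_n} u^{\mathrm{ASC}(e)}v^{\mathrm{row}(e)}, \] where for a set $S$ of positive integers $u^S = \prod_{i\in S} u_i$, with indeterminates $u_1, u_2, \dots$ and $v$.
   Context: Permutations $w \in \mathbb{S}_n$ are identified with words $w_1\dots w_n$. The descent set is $\mathrm{DES}(w) = \{i : w_i > w_{i+1}\}$, $\mathrm{des}(w) = \#\mathrm{DES}(w)$, and $\mathrm{ides}(w) = \mathrm{des}(w^{ -1})$ is the number of descents of the inverse permutation. An inversion table of length $n$ is a sequence $e = e_1\dots e_n$ of positive integers with $1 \leq e_i \leq i$ for all $i$; $\mathbb{I}_n$ is the set of these. For $e \in \mathbb{I}_n$, $\mathrm{ASC}(e) = \{i : e_i < e_{i+1}\}$, $\mathrm{ROW}(e) = \{e_i : 1\leq i\leq n\}\setminus\{1\}$, and $\mathrm{row}(e) = \#\mathrm{ROW}(e)$. -}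

module Defs where

open import Data.Bool using (Bool; true; false; if_then_else_; not; _∧_)
open import Data.Nat using (ℕ; zero; suc; _∸_; _≡ᵇ_; _<ᵇ_; _≤ᵇ_)
open import Data.List using (List; []; _∷_; map; concatMap; applyUpTo; filterᵇ; length; foldr)
open import Data.Bool.ListAction using (all; any)
open import Algebra.Bundles using (CommutativeSemiring)

-- Words are lists of natural numbers, positions are 1-based.
-- [a..b] : the list a, a+1, ..., b (empty if b < a)
range : ℕ → ℕ → List ℕ
range a b = applyUpTo (λ k → a Data.Nat.+ k) (suc b ∸ a)

-- w_i (1-based); 0 if out of range
at : List ℕ → ℕ → ℕ
at []       _             = 0
at (x ∷ xs) zero          = 0
at (x ∷ xs) (suc zero)    = x
at (x ∷ xs) (suc (suc i)) = at xs (suc i)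

words : ℕ → ℕ → List (List ℕ)
words zero    m = [] ∷ []
words (suc k) m = concatMap (λ x → map (x ∷_) (words k m)) (range 1 m)

distinct : List ℕ → Bool
distinct [] = true
distinct (x ∷ xs) = not (any (x ≡ᵇ_) xs) ∧ distinct xs

perms : ℕ → List (List ℕ)
perms n = filterᵇ distinct (words n n)

isInvTable : List ℕ → Bool
isInvTable e = all (λ i → (1 ≤ᵇ at e i) ∧ (at e i ≤ᵇ i)) (range 1 (length e))

invTables : ℕ → List (List ℕ)
invTables n = filterᵇ isInvTable (words n n)

DES : List ℕ → List ℕ
DES w = filterᵇ (λ i → at w (suc i) <ᵇ at w i) (range 1 (length w ∸ 1))

des : List ℕ → ℕ
des w = length (DES w)

-- position (1-based) of the first occurrence of j in w; 0 if absent
pos : ℕ → List ℕ → ℕ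
pos j [] = 0
pos j (x ∷ xs) = if j ≡ᵇ x then 1 else (if pos j xs ≡ᵇ 0 then 0 else suc (pos j xs))

inverse : List ℕ → List ℕ
inverse w = map (λ j → pos j w) (range 1 (length w))

ides : List ℕ → ℕ
ides w = des (inverse w)

ASC : List ℕ → List ℕ
ASC e = filterᵇ (λ i → at e i <ᵇ at e (suc i)) (range 1 (length e ∸ 1))

-- ROW(e) = { e_i } \ {1}; entries of e lie in {1..n}, so ROW(e) ⊆ {2..n}
ROW : List ℕ → List ℕ
ROW e = filterᵇ (λ j → any (j ≡ᵇ_) e) (range 2 (length e))

row : List ℕ → ℕ
row e = length (ROW e)

module _ {c ℓ} (R : CommutativeSemiring c ℓ) where
  open CommutativeSemiring R

  sumR : List Carrier → Carrier
  sumR = foldr _+_ 0#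

  pow : Carrier → ℕ → Carrier
  pow v zero    = 1#
  pow v (suc k) = v * pow v k

  -- u^S = ∏_{i ∈ S} u_i  (S given as a duplicate-free list)
  monoS : (ℕ → Carrier) → List ℕ → Carrier
  monoS u S = foldr (λ i r → u i * r) 1# S

-- Both sides are generated one letter at a time. Every permutation of length n + 1 arises exactly once from one of
-- length n by appending a last letter x ∈ [1, n + 1] and shifting up the letters ≥ x, and every inversion table of
-- length n + 1 by appending an entry y ∈ [1, n + 1] to one of length n. The weight gained by a step depends only on a
-- small state: the last letter and the inverse-descent flags of the permutation, respectively the last entry and the
-- set of values used by the table. Summing over all continuations of a state gives generating functions permGF and
-- tableGF, and both sides of the theorem are these functions at the states of length 1.
--
-- Under the reflection x ↦ n + 2 − x a step on the left becomes a step on the right: a descent at the new position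
-- becomes an ascent, and a new inverse descent becomes a new value. The successor states then agree except for an
-- extra unused value at y + 1. This does not matter, since tableGF is invariant under exchanging the marks of two
-- adjacent values i, i + 1 other than the last entry: swapping i and i + 1 in the continuations is a weight-preserving
-- involution on those that miss one of them, and a continuation containing both has the same weight for either marking.

module Submission where

open import Algebra.Bundles using (CommutativeSemiring)
open import Level using (Level)
open import Data.Bool using (Bool; true; false; T; if_then_else_; not; _∧_; _∨_)
import Data.Bool.Properties as Boolₚ
open import Data.Bool.ListAction using (all; any; and)
open import Data.Empty using (⊥-elim)
open import Data.List using (List; []; _∷_; [_]; _++_; _∷ʳ_; map; concatMap; filterᵇ; applyUpTo; length; foldr)
import Data.List.Properties as Listₚ
open import Data.Nat using (ℕ; zero; suc; _+_; _∸_; _≤_; _<_; z≤n; s≤s; z<s; _≡ᵇ_; _<ᵇ_; _≤ᵇ_)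
import Data.Nat.Properties as ℕₚ
open import Data.Nat.ListAction using (sum)
open import Data.Nat.ListAction.Properties using (sum-++)
open import Data.Nat.Tactic.RingSolver using (solve-∀)
open import Data.List.Relation.Unary.All as All using (All; []; _∷_)
import Data.List.Relation.Unary.All.Properties as Allₚ
open import Data.Product using (_×_; _,_)
open import Data.Sum using (_⊎_; inj₁; inj₂)
open import Function using (_∘_)
open import Relation.Binary.Definitions using (tri<; tri≈; tri>)
open import Relation.Binary.PropositionalEquality as ≡ using (_≡_; _≢_; refl; cong; cong₂; subst; subst₂)
open import Relation.Nullary using (¬_; yes; no)
import Relation.Nullary.Reflects as Reflects
open import Defs

T⇒≡true : ∀ {b} → T b → b ≡ true
T⇒≡true {true} _ = refl

¬T⇒≡false : ∀ {b} → ¬ T b → b ≡ false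
¬T⇒≡false {false} _  = refl
¬T⇒≡false {true}  ¬t = ⊥-elim (¬t _)

≡false⇒¬T : ∀ {b} → b ≡ false → ¬ T b
≡false⇒¬T refl ()

≡ᵇ-refl : ∀ n → (n ≡ᵇ n) ≡ true
≡ᵇ-refl n = T⇒≡true (ℕₚ.≡⇒≡ᵇ n n refl)

≢⇒≡ᵇ-false : ∀ {m n} → m ≢ n → (m ≡ᵇ n) ≡ false
≢⇒≡ᵇ-false {m} {n} m≢n = ¬T⇒≡false (m≢n ∘ ℕₚ.≡ᵇ⇒≡ m n)

≡ᵇ-false⇒≢ : ∀ {m n} → (m ≡ᵇ n) ≡ false → m ≢ n
≡ᵇ-false⇒≢ {m} {n} eq = ≡false⇒¬T eq ∘ ℕₚ.≡⇒≡ᵇ m n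

≡ᵇ-sym : ∀ m n → (m ≡ᵇ n) ≡ (n ≡ᵇ m)
≡ᵇ-sym zero    zero    = refl
≡ᵇ-sym zero    (suc n) = refl
≡ᵇ-sym (suc m) zero    = refl
≡ᵇ-sym (suc m) (suc n) = ≡ᵇ-sym m n

<⇒<ᵇ-true : ∀ {m n} → m < n → (m <ᵇ n) ≡ true
<⇒<ᵇ-true m<n = T⇒≡true (ℕₚ.<⇒<ᵇ m<n)

≤⇒<ᵇ-false : ∀ {m n} → n ≤ m → (m <ᵇ n) ≡ false
≤⇒<ᵇ-false {m} {n} n≤m = ¬T⇒≡false (ℕₚ.≤⇒≯ n≤m ∘ ℕₚ.<ᵇ⇒< m n)

≤⇒≤ᵇ-true : ∀ {m n} → m ≤ n → (m ≤ᵇ n) ≡ true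
≤⇒≤ᵇ-true m≤n = T⇒≡true (ℕₚ.≤⇒≤ᵇ m≤n)

<⇒≤ᵇ-false : ∀ {m n} → n < m → (m ≤ᵇ n) ≡ false
<⇒≤ᵇ-false {m} {n} n<m = ¬T⇒≡false (ℕₚ.<⇒≱ n<m ∘ ℕₚ.≤ᵇ⇒≤ m n)

≡ᵇ-⇔ : ∀ {a b c d} → (a ≡ b → c ≡ d) → (c ≡ d → a ≡ b) → (a ≡ᵇ b) ≡ (c ≡ᵇ d)
≡ᵇ-⇔ {a} {b} {c} {d} to from = Reflects.det
  (Reflects.fromEquivalence (to ∘ ℕₚ.≡ᵇ⇒≡ a b) (ℕₚ.≡⇒≡ᵇ a b ∘ from))
  (Reflects.fromEquivalence (ℕₚ.≡ᵇ⇒≡ c d) (ℕₚ.≡⇒≡ᵇ c d))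

<ᵇ-⇔ : ∀ {a b c d} → (a < b → c < d) → (c < d → a < b) → (a <ᵇ b) ≡ (c <ᵇ d)
<ᵇ-⇔ {a} {b} {c} {d} to from = Reflects.det
  (Reflects.fromEquivalence (to ∘ ℕₚ.<ᵇ⇒< a b) (ℕₚ.<⇒<ᵇ ∘ from))
  (ℕₚ.<ᵇ-reflects-< c d)

interval : ℕ → ℕ → List ℕ
interval a zero    = []
interval a (suc L) = a ∷ interval (suc a) L

range≡interval : ∀ a b → range a b ≡ interval a (suc b ∸ a)
range≡interval a b = applyUpTo-shift (a +_) a (suc b ∸ a) (λ _ → refl)
  where
  applyUpTo-shift : ∀ f a L → (∀ k → f k ≡ a + k) → applyUpTo f L ≡ interval a L
  applyUpTo-shift f a zero    eq = refl
  applyUpTo-shift f a (suc L) eq = cong₂ _∷_ (≡.trans (eq 0) (ℕₚ.+-identityʳ a))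
    (applyUpTo-shift (f ∘ suc) (suc a) L (λ k → ≡.trans (eq (suc k)) (ℕₚ.+-suc a k)))

interval-∷ʳ : ∀ a L → interval a (suc L) ≡ interval a L ++ [ a + L ]
interval-∷ʳ a zero    = cong [_] (≡.sym (ℕₚ.+-identityʳ a))
interval-∷ʳ a (suc L) = cong (a ∷_) (≡.trans (interval-∷ʳ (suc a) L) (cong (λ z → interval (suc a) L ++ [ z ]) (≡.sym (ℕₚ.+-suc a L))))

interval-suc : ∀ a L → interval (suc a) L ≡ map suc (interval a L)
interval-suc a zero    = refl
interval-suc a (suc L) = cong (suc a ∷_) (interval-suc (suc a) L)

interval-++ : ∀ a L M → interval a (L + M) ≡ interval a L ++ interval (a + L) M
interval-++ a zero    M = cong (λ z → interval z M) (≡.sym (ℕₚ.+-identityʳ a))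
interval-++ a (suc L) M = cong (a ∷_) (≡.trans (interval-++ (suc a) L M) (cong (λ z → interval (suc a) L ++ interval z M) (≡.sym (ℕₚ.+-suc a L))))

length-interval : ∀ a L → length (interval a L) ≡ L
length-interval a zero    = refl
length-interval a (suc L) = cong suc (length-interval (suc a) L)

<1+∸1⇒< : ∀ {i n} → 1 ≤ i → i < 1 + (n ∸ 1) → i < n
<1+∸1⇒< {n = zero}  1≤i (s≤s i≤0) = ⊥-elim (ℕₚ.<⇒≱ 1≤i i≤0)
<1+∸1⇒< {n = suc n} _   i<1+n    = i<1+n

interval-bounds : ∀ a L → All (λ x → a ≤ x × x < a + L) (interval a L)
interval-bounds a zero    = []
interval-bounds a (suc L) = (ℕₚ.≤-refl , ℕₚ.m<m+n a z<s) ∷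
  All.map (λ {x} (a<x , x<a+L) → ℕₚ.<⇒≤ a<x , subst (x <_) (≡.sym (ℕₚ.+-suc a L)) x<a+L) (interval-bounds (suc a) L)

map-interval-cong : ∀ {b} {B : Set b} a L {f g : ℕ → B} → (∀ x → a ≤ x → x < a + L → f x ≡ g x) →
                    map f (interval a L) ≡ map g (interval a L)
map-interval-cong a L eq = Listₚ.map-cong-local (All.map (λ (a≤x , x<a+L) → eq _ a≤x x<a+L) (interval-bounds a L))

punchIn : ℕ → ℕ → ℕ
punchIn x b = if b <ᵇ x then b else suc b

punchIn-< : ∀ {x b} → b < x → punchIn x b ≡ b
punchIn-< b<x rewrite <⇒<ᵇ-true b<x = refl

punchIn-≥ : ∀ {x b} → x ≤ b → punchIn x b ≡ suc b
punchIn-≥ x≤b rewrite ≤⇒<ᵇ-false x≤b = refl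

punchIn-mono-< : ∀ x {a b} → a < b → punchIn x a < punchIn x b
punchIn-mono-< x {a} {b} a<b with a ℕₚ.<? x | b ℕₚ.<? x
... | yes a<x | yes b<x rewrite punchIn-< a<x | punchIn-< b<x = a<b
... | yes a<x | no b≮x  rewrite punchIn-< a<x | punchIn-≥ (ℕₚ.≮⇒≥ b≮x) = ℕₚ.m≤n⇒m≤1+n a<b
... | no a≮x  | yes b<x = ⊥-elim (a≮x (ℕₚ.<-trans a<b b<x))
... | no a≮x  | no b≮x  rewrite punchIn-≥ (ℕₚ.≮⇒≥ a≮x) | punchIn-≥ (ℕₚ.≮⇒≥ b≮x) = s≤s a<b

punchIn-injective : ∀ x {a b} → punchIn x a ≡ punchIn x b → a ≡ b
punchIn-injective x {a} {b} eq with ℕₚ.<-cmp a b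
... | tri< a<b _ _ = ⊥-elim (ℕₚ.<-irrefl eq (punchIn-mono-< x a<b))
... | tri≈ _ a≡b _ = a≡b
... | tri> _ _ b<a = ⊥-elim (ℕₚ.<-irrefl (≡.sym eq) (punchIn-mono-< x b<a))

punchIn-≡ᵇ : ∀ x a b → (punchIn x a ≡ᵇ punchIn x b) ≡ (a ≡ᵇ b)
punchIn-≡ᵇ x a b = ≡ᵇ-⇔ (punchIn-injective x) (cong (punchIn x))

punchIn-<ᵇ : ∀ x a b → (punchIn x a <ᵇ punchIn x b) ≡ (a <ᵇ b)
punchIn-<ᵇ x a b = <ᵇ-⇔ reflect (punchIn-mono-< x)
  where
  reflect : punchIn x a < punchIn x b → a < b
  reflect lt with ℕₚ.<-cmp a b
  ... | tri< a<b _ _ = a<b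
  ... | tri≈ _ refl _ = ⊥-elim (ℕₚ.<-irrefl refl lt)
  ... | tri> _ _ b<a = ⊥-elim (ℕₚ.<-asym lt (punchIn-mono-< x b<a))

punchIn-≢ : ∀ x b → punchIn x b ≢ x
punchIn-≢ x b eq with b ℕₚ.<? x
... | yes b<x = ℕₚ.<⇒≢ b<x (≡.trans (≡.sym (punchIn-< b<x)) eq)
... | no b≮x  = ℕₚ.<⇒≢ (s≤s (ℕₚ.≮⇒≥ b≮x)) (≡.sym (≡.trans (≡.sym (punchIn-≥ (ℕₚ.≮⇒≥ b≮x))) eq))

<ᵇ-punchIn : ∀ x m → (x <ᵇ punchIn x m) ≡ (x ≤ᵇ m)
<ᵇ-punchIn x m with m ℕₚ.<? x
... | yes m<x rewrite punchIn-< m<x | ≤⇒<ᵇ-false (ℕₚ.<⇒≤ m<x) = ≡.sym (<⇒≤ᵇ-false m<x)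
... | no m≮x  rewrite punchIn-≥ (ℕₚ.≮⇒≥ m≮x) | <⇒<ᵇ-true (s≤s (ℕₚ.≮⇒≥ m≮x)) =
  ≡.sym (≤⇒≤ᵇ-true (ℕₚ.≮⇒≥ m≮x))

adjSwap : ℕ → ℕ → ℕ
adjSwap i y = if y ≡ᵇ i then suc i else (if y ≡ᵇ suc i then i else y)

adjSwap-i : ∀ i → adjSwap i i ≡ suc i
adjSwap-i i rewrite ≡ᵇ-refl i = refl

adjSwap-1+i : ∀ i → adjSwap i (suc i) ≡ i
adjSwap-1+i i rewrite ≢⇒≡ᵇ-false (ℕₚ.1+n≢n {i}) | ≡ᵇ-refl i = refl

adjSwap-other : ∀ {i y} → y ≢ i → y ≢ suc i → adjSwap i y ≡ y
adjSwap-other y≢i y≢1+i rewrite ≢⇒≡ᵇ-false y≢i | ≢⇒≡ᵇ-false y≢1+i = refl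

adjSwap-involutive : ∀ i y → adjSwap i (adjSwap i y) ≡ y
adjSwap-involutive i y with y ℕₚ.≟ i | y ℕₚ.≟ suc i
... | yes refl | _        = ≡.trans (cong (adjSwap i) (adjSwap-i i)) (adjSwap-1+i i)
... | no _     | yes refl = ≡.trans (cong (adjSwap i) (adjSwap-1+i i)) (adjSwap-i i)
... | no y≢i   | no y≢1+i = ≡.trans (cong (adjSwap i) (adjSwap-other y≢i y≢1+i)) (adjSwap-other y≢i y≢1+i)

adjSwap-≡ᵇ : ∀ i z y → (adjSwap i z ≡ᵇ y) ≡ (z ≡ᵇ adjSwap i y)
adjSwap-≡ᵇ i z y = ≡ᵇ-⇔ (λ eq → ≡.trans (≡.sym (adjSwap-involutive i z)) (cong (adjSwap i) eq))
                       (λ eq → ≡.trans (cong (adjSwap i) eq) (adjSwap-involutive i y))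

adjSwap-mono-< : ∀ i {m y} → m < y → ¬ (m ≡ i × y ≡ suc i) → adjSwap i m < adjSwap i y
adjSwap-mono-< i {m} {y} m<y ¬i,1+i with m ℕₚ.≟ i | m ℕₚ.≟ suc i | y ℕₚ.≟ i | y ℕₚ.≟ suc i
... | yes refl | _        | yes refl | _        = ⊥-elim (ℕₚ.<-irrefl refl m<y)
... | yes refl | _        | no _     | yes refl = ⊥-elim (¬i,1+i (refl , refl))
... | yes refl | _        | no y≢i   | no y≢1+i rewrite adjSwap-i m | adjSwap-other y≢i y≢1+i =
  ℕₚ.≤∧≢⇒< m<y (y≢1+i ∘ ≡.sym)
... | no _     | yes refl | yes refl | _        = ⊥-elim (ℕₚ.<-asym m<y (ℕₚ.n<1+n y))
... | no _     | yes refl | no _     | yes refl = ⊥-elim (ℕₚ.<-irrefl refl m<y)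
... | no _     | yes refl | no y≢i   | no y≢1+i rewrite adjSwap-1+i i | adjSwap-other y≢i y≢1+i =
  ℕₚ.<-trans (ℕₚ.n<1+n i) m<y
... | no m≢i   | no m≢1+i | yes refl | _        rewrite adjSwap-i y | adjSwap-other m≢i m≢1+i =
  ℕₚ.<-trans m<y (ℕₚ.n<1+n y)
... | no m≢i   | no m≢1+i | no _     | yes refl rewrite adjSwap-1+i i | adjSwap-other m≢i m≢1+i =
  ℕₚ.≤∧≢⇒< (ℕₚ.≤-pred m<y) m≢i
... | no m≢i   | no m≢1+i | no y≢i   | no y≢1+i rewrite adjSwap-other m≢i m≢1+i | adjSwap-other y≢i y≢1+i = m<y

adjSwap-<ᵇ : ∀ i {j} m y → j ≡ i ⊎ j ≡ suc i → m ≢ j → y ≢ j → (m <ᵇ y) ≡ (adjSwap i m <ᵇ adjSwap i y)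
adjSwap-<ᵇ i m y j∈ m≢j y≢j = <ᵇ-⇔ (λ m<y → adjSwap-mono-< i m<y (¬i,1+i j∈ m≢j y≢j)) reflect
  where
  ¬i,1+i : ∀ {j} → j ≡ i ⊎ j ≡ suc i → m ≢ j → y ≢ j → ¬ (m ≡ i × y ≡ suc i)
  ¬i,1+i (inj₁ refl) m≢j y≢j (m≡i , _)   = m≢j m≡i
  ¬i,1+i (inj₂ refl) m≢j y≢j (_ , y≡1+i) = y≢j y≡1+i
  unswap : ∀ {z k} → adjSwap i z ≡ k → z ≡ adjSwap i k
  unswap eq = ≡.trans (≡.sym (adjSwap-involutive i _)) (cong (adjSwap i) eq)
  ¬1+i,i : ∀ {j} → j ≡ i ⊎ j ≡ suc i → m ≢ j → y ≢ j → ¬ (adjSwap i m ≡ i × adjSwap i y ≡ suc i)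
  ¬1+i,i (inj₁ refl) m≢j y≢j (_ , y′≡1+i) = y≢j (≡.trans (unswap y′≡1+i) (adjSwap-1+i i))
  ¬1+i,i (inj₂ refl) m≢j y≢j (m′≡i , _)   = m≢j (≡.trans (unswap m′≡i) (adjSwap-i i))
  reflect : adjSwap i m < adjSwap i y → m < y
  reflect lt = subst₂ _<_ (adjSwap-involutive i m) (adjSwap-involutive i y) (adjSwap-mono-< i lt (¬1+i,i j∈ m≢j y≢j))

occurs : ℕ → List ℕ → Bool
occurs j = any (j ≡ᵇ_)

occurs-∷ : ∀ {p y} s → p ≢ y → occurs p (y ∷ s) ≡ occurs p s
occurs-∷ {p} s p≢y = cong (_∨ occurs p s) (≢⇒≡ᵇ-false p≢y)

occurs-adjSwap : ∀ i j s → occurs j (map (adjSwap i) s) ≡ occurs (adjSwap i j) s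
occurs-adjSwap i j []      = refl
occurs-adjSwap i j (y ∷ s) =
  cong₂ _∨_ (≡.trans (≡ᵇ-sym j (adjSwap i y)) (≡.trans (adjSwap-≡ᵇ i y j) (≡ᵇ-sym y (adjSwap i j)))) (occurs-adjSwap i j s)

map-adjSwap-involutive : ∀ i s → map (adjSwap i) (map (adjSwap i) s) ≡ s
map-adjSwap-involutive i []      = refl
map-adjSwap-involutive i (y ∷ s) = cong₂ _∷_ (adjSwap-involutive i y) (map-adjSwap-involutive i s)

at-∷ʳ : ∀ w x i → 1 ≤ i → i ≤ length w → at (w ∷ʳ x) i ≡ at w i
at-∷ʳ (a ∷ w) x (suc zero)    _ _       = refl
at-∷ʳ (a ∷ w) x (suc (suc i)) _ (s≤s i≤n) = at-∷ʳ w x (suc i) (s≤s z≤n) i≤n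

at-last : ∀ w x → at (w ∷ʳ x) (suc (length w)) ≡ x
at-last []      x = refl
at-last (a ∷ w) x = at-last w x

at-map : ∀ (f : ℕ → ℕ) w i → 1 ≤ i → i ≤ length w → at (map f w) i ≡ f (at w i)
at-map f (a ∷ w) (suc zero)    _ _         = refl
at-map f (a ∷ w) (suc (suc i)) _ (s≤s i≤n) = at-map f w (suc i) (s≤s z≤n) i≤n

at-interval : ∀ a L i → i < L → at (interval a L) (suc i) ≡ a + i
at-interval a (suc L) zero    _         = ≡.sym (ℕₚ.+-identityʳ a)
at-interval a (suc L) (suc i) (s≤s i<L) = ≡.trans (at-interval (suc a) L i i<L) (≡.sym (ℕₚ.+-suc a i))

length-∷ʳ : ∀ (w : List ℕ) x → length (w ∷ʳ x) ≡ suc (length w)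
length-∷ʳ []      x = refl
length-∷ʳ (a ∷ w) x = cong suc (length-∷ʳ w x)

occurs-∷ʳ : ∀ j w x → occurs j (w ∷ʳ x) ≡ occurs j w ∨ (j ≡ᵇ x)
occurs-∷ʳ j []      x = Boolₚ.∨-identityʳ (j ≡ᵇ x)
occurs-∷ʳ j (y ∷ w) x rewrite occurs-∷ʳ j w x = ≡.sym (Boolₚ.∨-assoc (j ≡ᵇ y) (occurs j w) (j ≡ᵇ x))

distinct-∷ʳ : ∀ w x → distinct (w ∷ʳ x) ≡ distinct w ∧ not (occurs x w)
distinct-∷ʳ []      x = refl
distinct-∷ʳ (a ∷ w) x rewrite occurs-∷ʳ a w x | distinct-∷ʳ w x | ≡ᵇ-sym a x
  with occurs a w | x ≡ᵇ a | distinct w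
... | true  | _     | _ = refl
... | false | false | _ = refl
... | false | true  | d = ≡.sym (Boolₚ.∧-zeroʳ _)

occurs-punchIn : ∀ x a w → occurs (punchIn x a) (map (punchIn x) w) ≡ occurs a w
occurs-punchIn x a []      = refl
occurs-punchIn x a (y ∷ w) = cong₂ _∨_ (punchIn-≡ᵇ x a y) (occurs-punchIn x a w)

occurs-punchIn-self : ∀ x w → occurs x (map (punchIn x) w) ≡ false
occurs-punchIn-self x []      = refl
occurs-punchIn-self x (y ∷ w) rewrite ≢⇒≡ᵇ-false (punchIn-≢ x y ∘ ≡.sym) = occurs-punchIn-self x w

distinct-punchIn : ∀ x w → distinct (map (punchIn x) w) ≡ distinct w
distinct-punchIn x []      = refl
distinct-punchIn x (a ∷ w) = cong₂ (λ b c → not b ∧ c) (occurs-punchIn x a w) (distinct-punchIn x w)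

pos-≤ : ∀ j w → pos j w ≤ length w
pos-≤ j []      = z≤n
pos-≤ j (x ∷ w) with j ≡ᵇ x
... | true = s≤s z≤n
... | false with pos j w ≡ᵇ 0
...   | true  = z≤n
...   | false = s≤s (pos-≤ j w)

pos-∷ʳ-≢ : ∀ j w x → j ≢ x → pos j (w ∷ʳ x) ≡ pos j w
pos-∷ʳ-≢ j []      x j≢x rewrite ≢⇒≡ᵇ-false j≢x = refl
pos-∷ʳ-≢ j (a ∷ w) x j≢x with j ≡ᵇ a
... | true  = refl
... | false rewrite pos-∷ʳ-≢ j w x j≢x = refl

pos-∷ʳ-new : ∀ j w → occurs j w ≡ false → pos j (w ∷ʳ j) ≡ suc (length w)
pos-∷ʳ-new j []      _ rewrite ≡ᵇ-refl j = refl
pos-∷ʳ-new j (a ∷ w) j∉a∷w with j ≡ᵇ a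
... | false rewrite pos-∷ʳ-new j w j∉a∷w = refl

pos-map : ∀ (g : ℕ → ℕ) j j′ w → (∀ y → (j ≡ᵇ g y) ≡ (j′ ≡ᵇ y)) → pos j (map g w) ≡ pos j′ w
pos-map g j j′ []      eq = refl
pos-map g j j′ (y ∷ w) eq rewrite eq y | pos-map g j j′ w eq = refl

filterᵇ-cong-All : ∀ {p q : ℕ → Bool} {xs} → All (λ x → p x ≡ q x) xs → filterᵇ p xs ≡ filterᵇ q xs
filterᵇ-cong-All [] = refl
filterᵇ-cong-All {p} {q} {x ∷ xs} (px≡qx ∷ eqs) rewrite px≡qx with q x
... | true  = cong (x ∷_) (filterᵇ-cong-All eqs)
... | false = filterᵇ-cong-All eqs

-- DES w and ASC w are, by definition, positionsWhere (λ a b → b <ᵇ a) w and positionsWhere _<ᵇ_ w.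
positionsWhere : (ℕ → ℕ → Bool) → List ℕ → List ℕ
positionsWhere c w = filterᵇ (λ i → c (at w i) (at w (suc i))) (range 1 (length w ∸ 1))

positionsWhere-map : ∀ c (f : ℕ → ℕ) w → (∀ a b → c (f a) (f b) ≡ c a b) → positionsWhere c (map f w) ≡ positionsWhere c w
positionsWhere-map c f w c-f rewrite Listₚ.length-map f w | range≡interval 1 (length w ∸ 1) =
  filterᵇ-cong-All (All.map (λ {i} (1≤i , i<n) → let 1+i≤n = <1+∸1⇒< 1≤i i<n in
                                ≡.trans (cong₂ c (at-map f w i 1≤i (ℕₚ.<⇒≤ 1+i≤n)) (at-map f w (suc i) (s≤s z≤n) 1+i≤n))
                                        (c-f (at w i) (at w (suc i))))
                            (interval-bounds 1 (length w ∸ 1)))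

bit : Bool → ℕ
bit b = if b then 1 else 0

count : (ℕ → Bool) → List ℕ → ℕ
count p xs = sum (map (bit ∘ p) xs)

length-filterᵇ : ∀ p xs → length (filterᵇ p xs) ≡ count p xs
length-filterᵇ p []       = refl
length-filterᵇ p (x ∷ xs) with p x
... | true  = cong suc (length-filterᵇ p xs)
... | false = length-filterᵇ p xs

count-++ : ∀ p xs ys → count p (xs ++ ys) ≡ count p xs + count p ys
count-++ p xs ys = ≡.trans (cong sum (Listₚ.map-++ (bit ∘ p) xs ys)) (sum-++ (map (bit ∘ p) xs) _)

count-interval-∷ʳ : ∀ p a L → count p (interval a (suc L)) ≡ count p (interval a L) + bit (p (a + L))
count-interval-∷ʳ p a L = ≡.trans (cong (count p) (interval-∷ʳ a L))
  (≡.trans (count-++ p (interval a L) [ a + L ]) (cong (count p (interval a L) +_) (ℕₚ.+-identityʳ _)))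

count-interval-cong : ∀ a L {p q : ℕ → Bool} → (∀ i → a ≤ i → i < a + L → p i ≡ q i) →
                      count p (interval a L) ≡ count q (interval a L)
count-interval-cong a L eq = cong sum (map-interval-cong a L (λ i a≤i i<a+L → cong bit (eq i a≤i i<a+L)))

mark : (ℕ → Bool) → ℕ → (ℕ → Bool)
mark U y z = if z ≡ᵇ y then true else U z

mark-cong : ∀ {U U′} y → (∀ z → U z ≡ U′ z) → ∀ z → mark U y z ≡ mark U′ y z
mark-cong y eq z = cong (if z ≡ᵇ y then true else_) (eq z)

mark-self : ∀ (W : ℕ → Bool) y → mark W y y ≡ true
mark-self W y = cong (if_then true else W y) (≡ᵇ-refl y)

mark-≢ : ∀ (W : ℕ → Bool) {y p} → p ≢ y → mark W y p ≡ W p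
mark-≢ W {p = p} p≢y = cong (if_then true else W p) (≢⇒≡ᵇ-false p≢y)

mark-agree : ∀ {W W′ : ℕ → Bool} {p} y → (∀ z → z ≢ p → W′ z ≡ W z) → ∀ z → z ≢ p → mark W′ y z ≡ mark W y z
mark-agree y agree z z≢p = cong (if z ≡ᵇ y then true else_) (agree z z≢p)

adjSwap-invariant : ∀ (U : ℕ → Bool) i → U i ≡ U (suc i) → ∀ z → U z ≡ U (adjSwap i z)
adjSwap-invariant U i eq z with z ℕₚ.≟ i | z ℕₚ.≟ suc i
... | yes refl | _        = ≡.trans eq (cong U (≡.sym (adjSwap-i z)))
... | no _     | yes refl = ≡.trans (≡.sym eq) (cong U (≡.sym (adjSwap-1+i i)))
... | no z≢i   | no z≢1+i = cong U (≡.sym (adjSwap-other z≢i z≢1+i))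

insertGap : ℕ → (ℕ → Bool) → (ℕ → Bool)
insertGap p V z = if z <ᵇ p then V z else (if z ≡ᵇ p then false else V (z ∸ 1))

insertGap-< : ∀ {p z} V → z < p → insertGap p V z ≡ V z
insertGap-< V z<p rewrite <⇒<ᵇ-true z<p = refl

insertGap-self : ∀ p V → insertGap p V p ≡ false
insertGap-self p V rewrite ≤⇒<ᵇ-false (ℕₚ.≤-refl {p}) | ≡ᵇ-refl p = refl

insertGap-> : ∀ {p z} V → p < z → insertGap p V z ≡ V (z ∸ 1)
insertGap-> V p<z rewrite ≤⇒<ᵇ-false (ℕₚ.<⇒≤ p<z) | ≢⇒≡ᵇ-false (ℕₚ.>⇒≢ p<z) = refl

insertGap-adjSwap : ∀ p V z → insertGap p V z ≡ insertGap (suc p) V (adjSwap p z)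
insertGap-adjSwap p V z with z ℕₚ.≟ p | z ℕₚ.≟ suc p
... | yes refl | _ rewrite adjSwap-i z = ≡.trans (insertGap-self z V) (≡.sym (insertGap-self (suc z) V))
... | no _ | yes refl rewrite adjSwap-1+i p = ≡.trans (insertGap-> V (ℕₚ.n<1+n p)) (≡.sym (insertGap-< V (ℕₚ.n<1+n p)))
... | no z≢p | no z≢1+p rewrite adjSwap-other z≢p z≢1+p with ℕₚ.<-cmp z p
...   | tri< z<p _ _ = ≡.trans (insertGap-< V z<p) (≡.sym (insertGap-< V (ℕₚ.<-trans z<p (ℕₚ.n<1+n p))))
...   | tri≈ _ z≡p _ = ⊥-elim (z≢p z≡p)
...   | tri> _ _ p<z = ≡.trans (insertGap-> V p<z) (≡.sym (insertGap-> V (ℕₚ.≤∧≢⇒< p<z (z≢1+p ∘ ≡.sym))))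

insertGap-beyond : ∀ p V → (∀ z → p ≤ z → V z ≡ false) → ∀ z → insertGap p V z ≡ V z
insertGap-beyond p V V≥p z with ℕₚ.<-cmp z p
... | tri< z<p _ _ = insertGap-< V z<p
... | tri≈ _ refl _ = ≡.trans (insertGap-self z V) (≡.sym (V≥p z ℕₚ.≤-refl))
... | tri> _ _ p<z@(s≤s p≤z-1) = ≡.trans (insertGap-> V p<z) (≡.trans (V≥p _ p≤z-1) (≡.sym (V≥p z (ℕₚ.<⇒≤ p<z))))

-- Building permutations by insertion

extend : List ℕ → ℕ → List ℕ
extend π x = map (punchIn x) π ∷ʳ x

permsByInsertion : ℕ → List (List ℕ)
permsByInsertion zero    = [] ∷ []
permsByInsertion (suc n) = concatMap (λ π → map (extend π) (interval 1 (suc n))) (permsByInsertion n)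

length-extend : ∀ π x → length (extend π x) ≡ suc (length π)
length-extend π x = ≡.trans (length-∷ʳ (map (punchIn x) π) x) (cong suc (Listₚ.length-map (punchIn x) π))

permsByInsertion-length : ∀ n → All (λ π → length π ≡ n) (permsByInsertion n)
permsByInsertion-length zero    = refl ∷ []
permsByInsertion-length (suc n) = Allₚ.concat⁺ (Allₚ.map⁺ (All.map
  (λ {π} len≡ → Allₚ.map⁺ (All.map (λ {x} _ → ≡.trans (length-extend π x) (cong suc len≡)) (interval-bounds 1 (suc n))))
  (permsByInsertion-length n)))

-- For 1 ≤ j < length π, whether j is a descent of π⁻¹. The flag is false at 0 and true from length π on;
-- with these conventions insertFlag describes the effect of extend uniformly.
ideFlag : List ℕ → ℕ → Bool
ideFlag π j = if j ≡ᵇ 0 then false else (if j <ᵇ length π then pos (suc j) π <ᵇ pos j π else true)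

insertFlag : ℕ → (ℕ → Bool) → (ℕ → Bool)
insertFlag x B j = if suc j <ᵇ x then B j else (if suc j ≡ᵇ x then false else (if j ≡ᵇ x then true else B (j ∸ 1)))

insertFlag-zero : ∀ x B → 1 ≤ x → B 0 ≡ false → insertFlag x B 0 ≡ false
insertFlag-zero (suc zero)    B _ B0 = refl
insertFlag-zero (suc (suc x)) B _ B0 = B0

insertFlag-< : ∀ x B j → suc j < x → insertFlag x B j ≡ B j
insertFlag-< x B j 1+j<x rewrite <⇒<ᵇ-true 1+j<x = refl

insertFlag-> : ∀ x B j → x ≤ j → insertFlag x B (suc j) ≡ B j
insertFlag-> x B j x≤j rewrite ≤⇒<ᵇ-false (ℕₚ.m≤n⇒m≤1+n (ℕₚ.m≤n⇒m≤1+n x≤j))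
  | ≢⇒≡ᵇ-false (ℕₚ.>⇒≢ (s≤s (ℕₚ.m≤n⇒m≤1+n x≤j))) | ≢⇒≡ᵇ-false (ℕₚ.>⇒≢ (s≤s x≤j)) = refl

pos-extend-< : ∀ π x j → j < x → pos j (extend π x) ≡ pos j π
pos-extend-< π x j j<x = ≡.trans (pos-∷ʳ-≢ j (map (punchIn x) π) x (ℕₚ.<⇒≢ j<x))
  (pos-map (punchIn x) j j π (λ y → ≡ᵇ-⇔ (unpunch y) (λ j≡y → ≡.trans j≡y (≡.sym (punchIn-< (subst (_< x) j≡y j<x))))))
  where
  unpunch : ∀ y → j ≡ punchIn x y → j ≡ y
  unpunch y j≡y′ with y ℕₚ.<? x
  ... | yes y<x = ≡.trans j≡y′ (punchIn-< y<x)
  ... | no y≮x  = ⊥-elim (ℕₚ.<⇒≱ j<x (ℕₚ.≤-trans (ℕₚ.≮⇒≥ y≮x)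
                    (ℕₚ.≤-trans (ℕₚ.n≤1+n y) (ℕₚ.≤-reflexive (≡.sym (≡.trans j≡y′ (punchIn-≥ (ℕₚ.≮⇒≥ y≮x))))))))

pos-extend-self : ∀ π x → pos x (extend π x) ≡ suc (length π)
pos-extend-self π x = ≡.trans (pos-∷ʳ-new x (map (punchIn x) π) (occurs-punchIn-self x π)) (cong suc (Listₚ.length-map (punchIn x) π))

pos-extend-> : ∀ π x j → x < suc j → pos (suc j) (extend π x) ≡ pos j π
pos-extend-> π x j x<1+j = ≡.trans (pos-∷ʳ-≢ (suc j) (map (punchIn x) π) x (ℕₚ.>⇒≢ x<1+j))
  (pos-map (punchIn x) (suc j) j π (λ y → ≡ᵇ-⇔ (unpunch y)
    (λ j≡y → ≡.trans (cong suc j≡y) (≡.sym (punchIn-≥ (subst (x ≤_) j≡y (ℕₚ.≤-pred x<1+j)))))))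
  where
  unpunch : ∀ y → suc j ≡ punchIn x y → j ≡ y
  unpunch y 1+j≡y′ with y ℕₚ.<? x
  ... | yes y<x = ⊥-elim (ℕₚ.<⇒≱ y<x (ℕₚ.≤-trans (ℕₚ.≤-pred x<1+j) (ℕₚ.<⇒≤ (ℕₚ.≤-reflexive (≡.trans 1+j≡y′ (punchIn-< y<x))))))
  ... | no y≮x  = ℕₚ.suc-injective (≡.trans 1+j≡y′ (punchIn-≥ (ℕₚ.≮⇒≥ y≮x)))

ideFlag-extend : ∀ π x → 1 ≤ x → x ≤ suc (length π) → ∀ j → ideFlag (extend π x) j ≡ insertFlag x (ideFlag π) j
ideFlag-extend π x 1≤x x≤1+n zero = ≡.sym (insertFlag-zero x (ideFlag π) 1≤x refl)
ideFlag-extend π x 1≤x x≤1+n (suc j) rewrite length-extend π x with ℕₚ.<-cmp (suc (suc j)) x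
... | tri< 2+j<x _ _ rewrite <⇒<ᵇ-true 2+j<x | <⇒<ᵇ-true {suc j} {suc (length π)} (ℕₚ.≤-trans (ℕₚ.<⇒≤ 2+j<x) x≤1+n)
        | <⇒<ᵇ-true {suc j} {length π} (ℕₚ.≤-pred (ℕₚ.≤-trans 2+j<x x≤1+n))
        | pos-extend-< π x (suc (suc j)) 2+j<x | pos-extend-< π x (suc j) (ℕₚ.<-trans (ℕₚ.n<1+n _) 2+j<x) = refl
... | tri≈ _ refl _ rewrite ≤⇒<ᵇ-false (ℕₚ.≤-refl {suc (suc j)}) | ≡ᵇ-refl j | <⇒<ᵇ-true {suc j} {suc (length π)} x≤1+n
        | pos-extend-< π (suc (suc j)) (suc j) ℕₚ.≤-refl | pos-extend-self π (suc (suc j))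
        | ≤⇒<ᵇ-false {suc (length π)} {pos (suc j) π} (ℕₚ.m≤n⇒m≤1+n (pos-≤ (suc j) π)) = refl
... | tri> _ _ x<2+j with suc j ℕₚ.≟ x
...   | yes refl = last
  where
  last : (if suc j <ᵇ suc (length π) then pos (suc (suc j)) (extend π (suc j)) <ᵇ pos (suc j) (extend π (suc j)) else true)
         ≡ insertFlag (suc j) (ideFlag π) (suc j)
  last rewrite ≤⇒<ᵇ-false (ℕₚ.n≤1+n (suc j)) | ≢⇒≡ᵇ-false (ℕₚ.1+n≢n {suc j}) | ≡ᵇ-refl j with suc j <ᵇ suc (length π)
  ... | false = refl
  ... | true rewrite pos-extend-> π (suc j) (suc j) ℕₚ.≤-refl | pos-extend-self π (suc j) = <⇒<ᵇ-true (s≤s (pos-≤ (suc j) π))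
...   | no 1+j≢x = above
  where
  x<1+j = ℕₚ.≤∧≢⇒< (ℕₚ.≤-pred x<2+j) (1+j≢x ∘ ≡.sym)
  above : (if suc j <ᵇ suc (length π) then pos (suc (suc j)) (extend π x) <ᵇ pos (suc j) (extend π x) else true)
          ≡ insertFlag x (ideFlag π) (suc j)
  above rewrite ≤⇒<ᵇ-false (ℕₚ.<⇒≤ x<2+j) | ≢⇒≡ᵇ-false (ℕₚ.>⇒≢ x<2+j) | ≢⇒≡ᵇ-false 1+j≢x
    | ≢⇒≡ᵇ-false (ℕₚ.>⇒≢ (ℕₚ.≤-trans 1≤x (ℕₚ.≤-pred x<1+j)))
    | pos-extend-> π x (suc j) (ℕₚ.<-trans x<1+j (ℕₚ.n<1+n _)) | pos-extend-> π x j x<1+j = refl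

ideFlag-length : ∀ π → 1 ≤ length π → ideFlag π (length π) ≡ true
ideFlag-length π 1≤n with length π
... | suc n rewrite ≤⇒<ᵇ-false (ℕₚ.≤-refl {suc n}) = refl

length-inverse : ∀ π → length (inverse π) ≡ length π
length-inverse π = ≡.trans (Listₚ.length-map _ (range 1 (length π))) (Listₚ.length-applyUpTo _ (length π))

at-inverse : ∀ π i → 1 ≤ i → i ≤ length π → at (inverse π) i ≡ pos i π
at-inverse π (suc i) 1≤i i≤n = ≡.trans
  (at-map (λ j → pos j π) (range 1 (length π)) (suc i) 1≤i
     (subst (suc i ≤_) (≡.sym (≡.trans (cong length (range≡interval 1 (length π))) (length-interval 1 (length π)))) i≤n))
  (cong (λ z → pos z π) (≡.trans (cong (λ l → at l (suc i)) (range≡interval 1 (length π))) (at-interval 1 (length π) i i≤n)))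

ides≡count : ∀ π → ides π ≡ count (ideFlag π) (interval 1 (length π ∸ 1))
ides≡count π = ≡.trans (length-filterᵇ P (range 1 (length (inverse π) ∸ 1)))
  (≡.trans (cong (count P) (range≡interval 1 (length (inverse π) ∸ 1)))
  (≡.trans (cong (λ l → count P (interval 1 (l ∸ 1))) (length-inverse π))
           (count-interval-cong 1 (length π ∸ 1) P≡ideFlag)))
  where
  P = λ i → at (inverse π) (suc i) <ᵇ at (inverse π) i
  P≡ideFlag : ∀ i → 1 ≤ i → i < 1 + (length π ∸ 1) → P i ≡ ideFlag π i
  P≡ideFlag (suc i) 1≤i i<n = ≡.trans
    (cong₂ _<ᵇ_ (at-inverse π (suc (suc i)) (s≤s z≤n) 2+i≤n) (at-inverse π (suc i) 1≤i (ℕₚ.<⇒≤ 2+i≤n)))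
    (≡.sym (cong (if_then pos (suc (suc i)) π <ᵇ pos (suc i) π else true) (<⇒<ᵇ-true 2+i≤n)))
    where 2+i≤n = <1+∸1⇒< 1≤i i<n

count-insertFlag-last : ∀ B m → count (insertFlag (suc m) B) (interval 1 m) ≡ count B (interval 1 (m ∸ 1))
count-insertFlag-last B zero    = refl
count-insertFlag-last B (suc m) rewrite count-interval-∷ʳ (insertFlag (suc (suc m)) B) 1 m
  | count-interval-cong 1 m (λ j _ j<1+m → insertFlag-< (suc (suc m)) B j (s≤s j<1+m))
  | ≤⇒<ᵇ-false (ℕₚ.≤-refl {suc (suc m)}) | ≡ᵇ-refl m = ℕₚ.+-identityʳ _

count-insertFlag-below : ∀ B n x → 1 ≤ x → x ≤ n → B 0 ≡ false →
                         count (insertFlag x B) (interval 1 n) ≡ count B (interval 1 (n ∸ 1)) + bit (not (B (x ∸ 1)))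
count-insertFlag-below B zero    (suc x) _ () B0
count-insertFlag-below B (suc m) x 1≤x x≤1+m B0 with x ℕₚ.≟ suc m
... | yes refl rewrite count-interval-∷ʳ (insertFlag (suc m) B) 1 m | count-insertFlag-last B m
      | ≤⇒<ᵇ-false (ℕₚ.n≤1+n (suc m)) | ≢⇒≡ᵇ-false (ℕₚ.1+n≢n {suc m}) | ≡ᵇ-refl m = tail m
  where
  tail : ∀ m → count B (interval 1 (m ∸ 1)) + 1 ≡ count B (interval 1 m) + bit (not (B m))
  tail zero rewrite B0 = refl
  tail (suc m) rewrite count-interval-∷ʳ B 1 m with B (suc m)
  ... | true  = ≡.sym (ℕₚ.+-identityʳ _)
  ... | false = cong (_+ 1) (≡.sym (ℕₚ.+-identityʳ _))
... | no x≢1+m with ℕₚ.≤-pred (ℕₚ.≤∧≢⇒< x≤1+m x≢1+m)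
...   | x≤m rewrite count-interval-∷ʳ (insertFlag x B) 1 m | count-insertFlag-below B m x 1≤x x≤m B0
        | insertFlag-> x B m x≤m = last m (ℕₚ.≤-trans 1≤x x≤m)
  where
  open import Algebra.Properties.CommutativeSemigroup ℕₚ.+-commutativeSemigroup using (xy∙z≈xz∙y)
  last : ∀ m → 1 ≤ m → count B (interval 1 (m ∸ 1)) + bit (not (B (x ∸ 1))) + bit (B m) ≡ count B (interval 1 m) + bit (not (B (x ∸ 1)))
  last (suc m) _ rewrite count-interval-∷ʳ B 1 m = xy∙z≈xz∙y (count B (interval 1 m)) (bit (not (B (x ∸ 1)))) (bit (B (suc m)))

count-insertFlag : ∀ B n x → 1 ≤ x → x ≤ suc n → B 0 ≡ false → B n ≡ true →
                   count (insertFlag x B) (interval 1 n) ≡ count B (interval 1 (n ∸ 1)) + bit (not (B (x ∸ 1)))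
count-insertFlag B n x 1≤x x≤1+n B0 Bn with x ℕₚ.≟ suc n
... | yes refl rewrite count-insertFlag-last B n | Bn = ≡.sym (ℕₚ.+-identityʳ _)
... | no x≢1+n = count-insertFlag-below B n x 1≤x (ℕₚ.≤-pred (ℕₚ.≤∧≢⇒< x≤1+n x≢1+n)) B0

ides-extend : ∀ π x → 1 ≤ length π → 1 ≤ x → x ≤ suc (length π) → ides (extend π x) ≡ ides π + bit (not (ideFlag π (x ∸ 1)))
ides-extend π x 1≤n 1≤x x≤1+n = begin
  ides (extend π x)                                               ≡⟨ ides≡count (extend π x) ⟩
  count (ideFlag (extend π x)) (interval 1 (length (extend π x) ∸ 1))
    ≡⟨ cong (λ l → count (ideFlag (extend π x)) (interval 1 (l ∸ 1))) (length-extend π x) ⟩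
  count (ideFlag (extend π x)) (interval 1 (length π))
    ≡⟨ count-interval-cong 1 (length π) (λ i _ _ → ideFlag-extend π x 1≤x x≤1+n i) ⟩
  count (insertFlag x (ideFlag π)) (interval 1 (length π))
    ≡⟨ count-insertFlag (ideFlag π) (length π) x 1≤x x≤1+n refl (ideFlag-length π 1≤n) ⟩
  count (ideFlag π) (interval 1 (length π ∸ 1)) + bit (not (ideFlag π (x ∸ 1)))
    ≡⟨ cong (_+ bit (not (ideFlag π (x ∸ 1)))) (≡.sym (ides≡count π)) ⟩
  ides π + bit (not (ideFlag π (x ∸ 1)))                          ∎
  where open ≡.≡-Reasoning

-- Building inversion tables by appending

tablesByAppending : ℕ → List (List ℕ)
tablesByAppending zero    = [] ∷ []
tablesByAppending (suc n) = concatMap (λ e → map (e ∷ʳ_) (interval 1 (suc n))) (tablesByAppending n)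

TableShape : ℕ → List ℕ → Set
TableShape n e = length e ≡ n × (1 ≤ n → occurs 1 e ≡ true) × (∀ z → n < z → occurs z e ≡ false)

TableShape-∷ʳ : ∀ n e x → TableShape n e → 1 ≤ x → x ≤ suc n → TableShape (suc n) (e ∷ʳ x)
TableShape-∷ʳ n e x (len≡ , 1∈e , >n∉e) 1≤x x≤1+n =
  ≡.trans (length-∷ʳ e x) (cong suc len≡) ,
  (λ _ → ≡.trans (occurs-∷ʳ 1 e x) (one n x≤1+n 1∈e)) ,
  (λ z 1+n<z → ≡.trans (occurs-∷ʳ z e x)
     (cong₂ _∨_ (>n∉e z (ℕₚ.<-trans (ℕₚ.n<1+n n) 1+n<z)) (≢⇒≡ᵇ-false (ℕₚ.>⇒≢ (ℕₚ.≤-<-trans x≤1+n 1+n<z)))))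
  where
  one : ∀ n → x ≤ suc n → (1 ≤ n → occurs 1 e ≡ true) → (occurs 1 e ∨ (1 ≡ᵇ x)) ≡ true
  one zero    x≤1 _   rewrite ℕₚ.≤-antisym x≤1 1≤x = Boolₚ.∨-zeroʳ (occurs 1 e)
  one (suc n) _   1∈e rewrite 1∈e (s≤s z≤n) = refl

tablesByAppending-shape : ∀ n → All (TableShape n) (tablesByAppending n)
tablesByAppending-shape zero    = (refl , (λ ()) , (λ _ _ → refl)) ∷ []
tablesByAppending-shape (suc n) = Allₚ.concat⁺ (Allₚ.map⁺ (All.map
  (λ {e} shape → Allₚ.map⁺ (All.map (λ {x} (1≤x , x<2+n) → TableShape-∷ʳ n e x shape 1≤x (ℕₚ.≤-pred x<2+n)) (interval-bounds 1 (suc n))))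
  (tablesByAppending-shape n)))

all-++ : ∀ (p : ℕ → Bool) xs ys → all p (xs ++ ys) ≡ all p xs ∧ all p ys
all-++ p []       ys = refl
all-++ p (x ∷ xs) ys rewrite all-++ p xs ys = ≡.sym (Boolₚ.∧-assoc (p x) _ _)

isInvTable-∷ʳ : ∀ e x → isInvTable (e ∷ʳ x) ≡ isInvTable e ∧ ((1 ≤ᵇ x) ∧ (x ≤ᵇ suc (length e)))
isInvTable-∷ʳ e x = begin
  all Q (range 1 (length (e ∷ʳ x)))      ≡⟨ cong (λ l → all Q (range 1 l)) (length-∷ʳ e x) ⟩
  all Q (range 1 (suc L))                ≡⟨ cong (all Q) (≡.trans (range≡interval 1 (suc L)) (interval-∷ʳ 1 L)) ⟩
  all Q (interval 1 L ++ [ suc L ])      ≡⟨ all-++ Q (interval 1 L) [ suc L ] ⟩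
  all Q (interval 1 L) ∧ (Q (suc L) ∧ true)
    ≡⟨ cong₂ _∧_ (cong and (map-interval-cong 1 L (λ i 1≤i i<1+L →
                              cong (λ z → (1 ≤ᵇ z) ∧ (z ≤ᵇ i)) (at-∷ʳ e x i 1≤i (ℕₚ.≤-pred i<1+L)))))
                 (Boolₚ.∧-identityʳ _) ⟩
  all Q′ (interval 1 L) ∧ Q (suc L)
    ≡⟨ cong₂ _∧_ (≡.sym (cong (all Q′) (range≡interval 1 L))) (cong (λ z → (1 ≤ᵇ z) ∧ (z ≤ᵇ suc L)) (at-last e x)) ⟩
  isInvTable e ∧ ((1 ≤ᵇ x) ∧ (x ≤ᵇ suc L)) ∎
  where
  open ≡.≡-Reasoning
  L  = length e
  Q  = λ i → (1 ≤ᵇ at (e ∷ʳ x) i) ∧ (at (e ∷ʳ x) i ≤ᵇ i)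
  Q′ = λ i → (1 ≤ᵇ at e i) ∧ (at e i ≤ᵇ i)

row≡count : ∀ e → row e ≡ count (λ j → occurs j e) (interval 2 (length e ∸ 1))
row≡count e = ≡.trans (length-filterᵇ (λ j → occurs j e) (range 2 (length e))) (cong (count (λ j → occurs j e)) (range≡interval 2 (length e)))

count-∨-≡ᵇ-outside : ∀ a L (f : ℕ → Bool) x → (∀ i → a ≤ i → i < a + L → i ≢ x) →
                     count (λ j → f j ∨ (j ≡ᵇ x)) (interval a L) ≡ count f (interval a L)
count-∨-≡ᵇ-outside a L f x outside =
  count-interval-cong a L (λ i a≤i i<a+L → ≡.trans (cong (f i ∨_) (≢⇒≡ᵇ-false (outside i a≤i i<a+L))) (Boolₚ.∨-identityʳ (f i)))

count-∨-≡ᵇ-inside : ∀ a L (f : ℕ → Bool) x → a ≤ x → x < a + L →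
                    count (λ j → f j ∨ (j ≡ᵇ x)) (interval a L) ≡ count f (interval a L) + bit (not (f x))
count-∨-≡ᵇ-inside a zero    f x a≤x x<a = ⊥-elim (ℕₚ.<⇒≱ x<a (subst (_≤ x) (≡.sym (ℕₚ.+-identityʳ a)) a≤x))
count-∨-≡ᵇ-inside a (suc L) f x a≤x x<a+L with a ℕₚ.≟ x
... | yes refl rewrite ≡ᵇ-refl a | Boolₚ.∨-zeroʳ (f a) | count-∨-≡ᵇ-outside (suc a) L f a (λ i a<i _ → ℕₚ.>⇒≢ a<i) =
  ≡.trans (cong (_+ count f (interval (suc a) L)) (≡.sym (bit+bit-not (f a)))) (xy∙z≈xz∙y (bit (f a)) _ _)
  where
  open import Algebra.Properties.CommutativeSemigroup ℕₚ.+-commutativeSemigroup using (xy∙z≈xz∙y)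
  bit+bit-not : ∀ b → bit b + bit (not b) ≡ 1
  bit+bit-not true  = refl
  bit+bit-not false = refl
... | no a≢x rewrite ≢⇒≡ᵇ-false a≢x | Boolₚ.∨-identityʳ (f a)
      | count-∨-≡ᵇ-inside (suc a) L f x (ℕₚ.≤∧≢⇒< a≤x a≢x) (subst (x <_) (ℕₚ.+-suc a L) x<a+L) =
  ≡.sym (ℕₚ.+-assoc (bit (f a)) _ _)

row-∷ʳ : ∀ e x L → length e ≡ suc L → occurs 1 e ≡ true → occurs (suc (suc L)) e ≡ false → 1 ≤ x → x ≤ suc (suc L) →
         row (e ∷ʳ x) ≡ row e + bit (not (occurs x e))
row-∷ʳ e x L len≡ 1∈e 2+L∉e 1≤x x≤2+L = begin
  row (e ∷ʳ x)                                      ≡⟨ row≡count (e ∷ʳ x) ⟩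
  count f′ (interval 2 (length (e ∷ʳ x) ∸ 1))
    ≡⟨ cong (λ l → count f′ (interval 2 (l ∸ 1))) (≡.trans (length-∷ʳ e x) (cong suc len≡)) ⟩
  count f′ (interval 2 (suc L))                     ≡⟨ count-interval-∷ʳ f′ 2 L ⟩
  count f′ (interval 2 L) + bit (f′ (suc (suc L)))
    ≡⟨ cong₂ _+_ (count-interval-cong 2 L (λ i _ _ → occurs-∷ʳ i e x))
                 (cong bit (≡.trans (occurs-∷ʳ (suc (suc L)) e x) (cong (_∨ (suc (suc L) ≡ᵇ x)) 2+L∉e))) ⟩
  count (λ j → f j ∨ (j ≡ᵇ x)) (interval 2 L) + bit (suc (suc L) ≡ᵇ x) ≡⟨ by-position ⟩
  count f (interval 2 L) + bit (not (occurs x e))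
    ≡⟨ cong (_+ bit (not (occurs x e))) (≡.sym (≡.trans (row≡count e) (cong (λ l → count f (interval 2 (l ∸ 1))) len≡))) ⟩
  row e + bit (not (occurs x e))                    ∎
  where
  open ≡.≡-Reasoning
  f  = λ j → occurs j e
  f′ = λ j → occurs j (e ∷ʳ x)
  by-position : count (λ j → f j ∨ (j ≡ᵇ x)) (interval 2 L) + bit (suc (suc L) ≡ᵇ x) ≡ count f (interval 2 L) + bit (not (occurs x e))
  by-position with x ℕₚ.≟ 1 | x ℕₚ.≟ suc (suc L)
  ... | yes refl | _ rewrite count-∨-≡ᵇ-outside 2 L f 1 (λ i 1<i _ → ℕₚ.>⇒≢ 1<i) | 1∈e = refl
  ... | no _ | yes refl rewrite count-∨-≡ᵇ-outside 2 L f (suc (suc L)) (λ i _ i<2+L → ℕₚ.<⇒≢ i<2+L) | 2+L∉e | ≡ᵇ-refl L = refl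
  ... | no x≢1 | no x≢2+L rewrite count-∨-≡ᵇ-inside 2 L f x (ℕₚ.≤∧≢⇒< 1≤x (x≢1 ∘ ≡.sym)) (ℕₚ.≤∧≢⇒< x≤2+L x≢2+L)
        | ≢⇒≡ᵇ-false (x≢2+L ∘ ≡.sym) = ℕₚ.+-identityʳ _

-- Reflecting values

-- Reads the flags of a permutation of length n as a set of table values: z is marked iff n + 1 − z is flagged.
reflectFlags : ℕ → (ℕ → Bool) → (ℕ → Bool)
reflectFlags n B z = if z ≡ᵇ 0 then false else B (suc n ∸ z)

module _ (n x y : ℕ) (B : ℕ → Bool) (x+y≡ : x + y ≡ suc (suc n)) where

  insertFlag-reflected-< : ∀ z → suc z < y → insertFlag x B (suc n ∸ z) ≡ B (n ∸ z)
  insertFlag-reflected-< z 1+z<y = ≡.trans (cong (insertFlag x B) (≡.trans (cong (λ m → suc m ∸ z) n≡x+d+z) (ℕₚ.m+n∸n≡m (suc (x + d)) z)))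
    (≡.trans (insertFlag-> x B (x + d) (ℕₚ.m≤m+n x d)) (cong B (≡.sym n∸z≡)))
    where
    d = y ∸ suc (suc z)
    rearrange : ∀ x z d → x + (suc (suc z) + d) ≡ suc (suc ((x + d) + z))
    rearrange = solve-∀
    n≡x+d+z : n ≡ (x + d) + z
    n≡x+d+z = ℕₚ.suc-injective (ℕₚ.suc-injective
      (≡.trans (≡.sym x+y≡) (≡.trans (cong (x +_) (≡.sym (ℕₚ.m+[n∸m]≡n 1+z<y))) (rearrange x z d))))
    n∸z≡ : n ∸ z ≡ x + d
    n∸z≡ = ≡.trans (cong (_∸ z) n≡x+d+z) (ℕₚ.m+n∸n≡m (x + d) z)

  insertFlag-reflected-≡ : ∀ z → suc z ≡ y → insertFlag x B (suc n ∸ z) ≡ true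
  insertFlag-reflected-≡ z refl rewrite ℕₚ.suc-injective (≡.trans (≡.sym x+y≡) (ℕₚ.+-suc x z)) | ℕₚ.m+n∸n≡m x z
    | ≤⇒<ᵇ-false (ℕₚ.n≤1+n x) | ≢⇒≡ᵇ-false (ℕₚ.1+n≢n {x}) | ≡ᵇ-refl x = refl

  insertFlag-reflected-> : 1 ≤ x → B 0 ≡ false → ∀ z → y < z → insertFlag x B (suc n ∸ z) ≡ B (suc n ∸ z)
  insertFlag-reflected-> 1≤x B0 z y<z with ℕₚ.≤-total (suc n) z
  ... | inj₁ 1+n≤z rewrite ℕₚ.m≤n⇒m∸n≡0 1+n≤z = ≡.trans (insertFlag-zero x B 1≤x B0) (≡.sym B0)
  ... | inj₂ z≤1+n = insertFlag-< x B (suc n ∸ z) (ℕₚ.+-cancelʳ-≤ y (suc (suc (suc n ∸ z))) x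
        (ℕₚ.≤-trans (s≤s (ℕₚ.+-monoʳ-< (suc n ∸ z) y<z))
                    (ℕₚ.≤-reflexive (≡.trans (cong suc (ℕₚ.m∸n+n≡m z≤1+n)) (≡.sym x+y≡)))))

insertFlag-reflected-gap : ∀ n x y B → x + y ≡ suc (suc n) → 1 ≤ x → insertFlag x B (suc n ∸ y) ≡ false
insertFlag-reflected-gap n (suc x) y B x+y≡ _ rewrite ≡.sym (ℕₚ.suc-injective x+y≡) | ℕₚ.m+n∸n≡m x y
  | ≤⇒<ᵇ-false (ℕₚ.≤-refl {suc x}) | ≡ᵇ-refl x = refl

-- Inserting x into a permutation of length n + 1 matches appending y = n + 2 − x to a table, up to a gap at y + 1.
reflectFlags-insertFlag : ∀ n x y B → x + y ≡ suc (suc n) → 1 ≤ x → 1 ≤ y → B 0 ≡ false →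
  ∀ z → reflectFlags (suc n) (insertFlag x B) z ≡ insertGap (suc y) (mark (reflectFlags n B) y) z
reflectFlags-insertFlag n x (suc y) B x+y≡ 1≤x _ B0 zero = refl
reflectFlags-insertFlag n x y B x+y≡ 1≤x 1≤y B0 (suc z) with ℕₚ.<-cmp (suc z) y
... | tri< 1+z<y _ _ = ≡.trans (insertFlag-reflected-< n x y B x+y≡ z 1+z<y)
  (≡.sym (≡.trans (insertGap-< U (ℕₚ.<-trans 1+z<y (ℕₚ.n<1+n y))) (mark-≢ (reflectFlags n B) (ℕₚ.<⇒≢ 1+z<y))))
  where U = mark (reflectFlags n B) y
... | tri≈ _ refl _ = ≡.trans (insertFlag-reflected-≡ n x y B x+y≡ z refl)
  (≡.sym (≡.trans (insertGap-< (mark (reflectFlags n B) y) (ℕₚ.n<1+n y)) (mark-self (reflectFlags n B) y)))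
... | tri> _ _ y<1+z with suc z ℕₚ.≟ suc y
...   | yes refl = ≡.trans (insertFlag-reflected-gap n x y B x+y≡ 1≤x) (≡.sym (insertGap-self (suc y) (mark (reflectFlags n B) y)))
...   | no 1+z≢1+y = ≡.trans (insertFlag-reflected-> n x y B x+y≡ 1≤x B0 z y<z)
  (≡.sym (≡.trans (insertGap-> (mark (reflectFlags n B) y) 1+y<1+z)
                  (≡.trans (mark-≢ (reflectFlags n B) (ℕₚ.>⇒≢ y<z)) (reflect-pos z (ℕₚ.≤-trans 1≤y (ℕₚ.<⇒≤ y<z))))))
  where
  1+y<1+z = ℕₚ.≤∧≢⇒< y<1+z (1+z≢1+y ∘ ≡.sym)
  y<z = ℕₚ.≤-pred 1+y<1+z
  reflect-pos : ∀ w → 0 < w → reflectFlags n B w ≡ B (suc n ∸ w)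
  reflect-pos (suc w) _ = refl

≤ᵇ-reflect : ∀ x y n m → x + y ≡ suc (suc n) → 1 ≤ x → m ≤ suc n → (x ≤ᵇ m) ≡ ((suc n ∸ m) <ᵇ y)
≤ᵇ-reflect (suc x) y n m x+y≡ _ m≤1+n = <ᵇ-⇔ to from
  where
  r = suc n ∸ m
  m+r≡ : m + r ≡ suc n
  m+r≡ = ℕₚ.m+[n∸m]≡n m≤1+n
  x+y≡1+n : x + y ≡ suc n
  x+y≡1+n = ℕₚ.suc-injective x+y≡
  to : x < m → r < y
  to x<m = ℕₚ.+-cancelˡ-< x r y (subst (x + r <_) (≡.trans m+r≡ (≡.sym x+y≡1+n)) (ℕₚ.+-monoˡ-< r x<m))
  from : r < y → x < m
  from r<y = ℕₚ.+-cancelʳ-< y x m (subst (_< m + y) (≡.sym x+y≡1+n) (subst (_< m + y) m+r≡ (ℕₚ.+-monoʳ-< m r<y)))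

reflectFlags-reflect : ∀ x y n B → x + y ≡ suc (suc n) → 1 ≤ x → 1 ≤ y → B (x ∸ 1) ≡ reflectFlags n B y
reflectFlags-reflect (suc x) (suc y) n B x+y≡ _ _ = cong B (≡.sym (≡.trans (cong (_∸ y) n≡x+y) (ℕₚ.m+n∸n≡m x y)))
  where
  n≡x+y : n ≡ x + y
  n≡x+y = ≡.sym (ℕₚ.suc-injective (≡.trans (≡.sym (ℕₚ.+-suc x y)) (ℕₚ.suc-injective x+y≡)))

module Sums {c ℓ} (R : CommutativeSemiring c ℓ) where

  open CommutativeSemiring R hiding (zero) renaming (_+_ to _⊕_; _*_ to _⊛_; refl to ≈-refl)
  open import Algebra.Properties.CommutativeSemigroup +-commutativeSemigroup using () renaming (interchange to +-interchange)
  open import Relation.Binary.Reasoning.Setoid setoid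

  private variable
    a b : Level
    A : Set a
    B : Set b

  ∑ : (A → Carrier) → List A → Carrier
  ∑ f xs = sumR R (map f xs)

  ∏ : (A → Carrier) → List A → Carrier
  ∏ f = foldr (λ x r → f x ⊛ r) 1#

  ∑-cong : ∀ {f g : A → Carrier} xs → (∀ x → f x ≈ g x) → ∑ f xs ≈ ∑ g xs
  ∑-cong []       eq = ≈-refl
  ∑-cong (x ∷ xs) eq = +-cong (eq x) (∑-cong xs eq)

  ∑-++ : ∀ (f : A → Carrier) xs ys → ∑ f (xs ++ ys) ≈ ∑ f xs ⊕ ∑ f ys
  ∑-++ f []       ys = sym (+-identityˡ _)
  ∑-++ f (x ∷ xs) ys = trans (+-cong ≈-refl (∑-++ f xs ys)) (sym (+-assoc _ _ _))

  ∏-++ : ∀ (f : A → Carrier) xs ys → ∏ f (xs ++ ys) ≈ ∏ f xs ⊛ ∏ f ys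
  ∏-++ f []       ys = sym (*-identityˡ _)
  ∏-++ f (x ∷ xs) ys = trans (*-cong ≈-refl (∏-++ f xs ys)) (sym (*-assoc _ _ _))

  ∑-zero : ∀ (xs : List A) → ∑ (λ _ → 0#) xs ≈ 0#
  ∑-zero []       = ≈-refl
  ∑-zero (x ∷ xs) = trans (+-identityˡ _) (∑-zero xs)

  ∑-distrib-+ : ∀ (f g : A → Carrier) xs → ∑ (λ x → f x ⊕ g x) xs ≈ ∑ f xs ⊕ ∑ g xs
  ∑-distrib-+ f g []       = sym (+-identityˡ _)
  ∑-distrib-+ f g (x ∷ xs) = trans (+-cong ≈-refl (∑-distrib-+ f g xs)) (+-interchange _ _ _ _)

  *-distribˡ-∑ : ∀ k (f : A → Carrier) xs → k ⊛ ∑ f xs ≈ ∑ (λ x → k ⊛ f x) xs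
  *-distribˡ-∑ k f []       = zeroʳ k
  *-distribˡ-∑ k f (x ∷ xs) = trans (distribˡ k _ _) (+-cong ≈-refl (*-distribˡ-∑ k f xs))

  ∑-filter : ∀ (p : A → Bool) (f : A → Carrier) xs → ∑ f (filterᵇ p xs) ≈ ∑ (λ x → if p x then f x else 0#) xs
  ∑-filter p f [] = ≈-refl
  ∑-filter p f (x ∷ xs) with p x
  ... | true  = +-cong ≈-refl (∑-filter p f xs)
  ... | false = trans (∑-filter p f xs) (sym (+-identityˡ _))

  ∏-filter : ∀ (p : A → Bool) (f : A → Carrier) xs → ∏ f (filterᵇ p xs) ≈ ∏ (λ x → if p x then f x else 1#) xs
  ∏-filter p f [] = ≈-refl
  ∏-filter p f (x ∷ xs) with p x
  ... | true  = *-cong ≈-refl (∏-filter p f xs)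
  ... | false = trans (∏-filter p f xs) (sym (*-identityˡ _))

  ∑-map : ∀ (f : B → Carrier) (g : A → B) xs → ∑ f (map g xs) ≡ ∑ (f ∘ g) xs
  ∑-map f g []       = refl
  ∑-map f g (x ∷ xs) = cong (f (g x) ⊕_) (∑-map f g xs)

  ∑-concatMap : ∀ (f : B → Carrier) (g : A → List B) xs → ∑ f (concatMap g xs) ≈ ∑ (λ x → ∑ f (g x)) xs
  ∑-concatMap f g []       = ≈-refl
  ∑-concatMap f g (x ∷ xs) = trans (∑-++ f (g x) (concatMap g xs)) (+-cong ≈-refl (∑-concatMap f g xs))

  ∑-comm : ∀ (f : A → B → Carrier) xs ys → ∑ (λ x → ∑ (f x) ys) xs ≈ ∑ (λ y → ∑ (λ x → f x y) xs) ys
  ∑-comm f []       ys = sym (∑-zero ys)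
  ∑-comm f (x ∷ xs) ys = trans (+-cong ≈-refl (∑-comm f xs ys)) (sym (∑-distrib-+ (f x) (λ y → ∑ (λ x → f x y) xs) ys))

  ∑-concatMap-map : ∀ {c} {C : Set c} (G : C → Carrier) (f : A → B → C) xs ys →
                    ∑ G (concatMap (λ x → map (f x) ys) xs) ≈ ∑ (λ x → ∑ (G ∘ f x) ys) xs
  ∑-concatMap-map G f xs ys = trans (∑-concatMap G (λ x → map (f x) ys) xs) (∑-cong xs (λ x → reflexive (∑-map G (f x) ys)))

  ∑-cong-All : ∀ {p} {P : A → Set p} {f g : A → Carrier} {xs} → All P xs → (∀ x → P x → f x ≈ g x) → ∑ f xs ≈ ∑ g xs
  ∑-cong-All             []       eq = ≈-refl
  ∑-cong-All {xs = x ∷ _} (px ∷ pxs) eq = +-cong (eq x px) (∑-cong-All pxs eq)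

  ∑-interval-cong : ∀ a L {f g : ℕ → Carrier} → (∀ x → a ≤ x → x < a + L → f x ≈ g x) →
                    ∑ f (interval a L) ≈ ∑ g (interval a L)
  ∑-interval-cong a L eq = ∑-cong-All (interval-bounds a L) (λ x (a≤x , x<a+L) → eq x a≤x x<a+L)

  ∏-interval-cong : ∀ a L {f g : ℕ → Carrier} → (∀ x → a ≤ x → x < a + L → f x ≈ g x) →
                    ∏ f (interval a L) ≈ ∏ g (interval a L)
  ∏-interval-cong a zero    eq = ≈-refl
  ∏-interval-cong a (suc L) eq = *-cong (eq a ℕₚ.≤-refl (ℕₚ.m<m+n a z<s))
    (∏-interval-cong (suc a) L (λ x a<x x<a+L → eq x (ℕₚ.<⇒≤ a<x) (subst (x <_) (≡.sym (ℕₚ.+-suc a L)) x<a+L)))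

  ∑-interval-suc : ∀ a L (f : ℕ → Carrier) → ∑ f (interval (suc a) L) ≡ ∑ (f ∘ suc) (interval a L)
  ∑-interval-suc a L f rewrite interval-suc a L = ∑-map f suc (interval a L)

  ∑-interval-punchIn : ∀ N a x (f : ℕ → Carrier) → a ≤ x → x ≤ a + N →
    ∑ (λ b → if b ≡ᵇ x then 0# else f b) (interval a (suc N)) ≈ ∑ (f ∘ punchIn x) (interval a N)
  ∑-interval-punchIn zero a x f a≤x x≤a with ℕₚ.≤-antisym a≤x (subst (x ≤_) (ℕₚ.+-identityʳ a) x≤a)
  ... | refl rewrite ≡ᵇ-refl a = +-identityˡ _
  ∑-interval-punchIn (suc N) a x f a≤x x≤a+N with a ℕₚ.≟ x
  ... | yes refl rewrite ≡ᵇ-refl a = begin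
    0# ⊕ ∑ (λ b → if b ≡ᵇ a then 0# else f b) (interval (suc a) (suc N)) ≈⟨ +-identityˡ _ ⟩
    ∑ (λ b → if b ≡ᵇ a then 0# else f b) (interval (suc a) (suc N))
      ≈⟨ ∑-interval-cong (suc a) (suc N) (λ b a<b _ → reflexive (cong (if_then 0# else f b) (≢⇒≡ᵇ-false (ℕₚ.>⇒≢ a<b)))) ⟩
    ∑ f (interval (suc a) (suc N))                                         ≡⟨ ∑-interval-suc a (suc N) f ⟩
    ∑ (f ∘ suc) (interval a (suc N))
      ≈⟨ ∑-interval-cong a (suc N) (λ b a≤b _ → reflexive (cong f (≡.sym (punchIn-≥ a≤b)))) ⟩
    ∑ (f ∘ punchIn a) (interval a (suc N))                                 ∎
  ... | no a≢x rewrite ≢⇒≡ᵇ-false a≢x | punchIn-< (ℕₚ.≤∧≢⇒< a≤x a≢x) =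
    +-cong ≈-refl (∑-interval-punchIn N (suc a) x f (ℕₚ.≤∧≢⇒< a≤x a≢x) (subst (x ≤_) (ℕₚ.+-suc a N) x≤a+N))

  ∑-interval-truncate : ∀ K d (f : ℕ → Carrier) →
    ∑ (λ x → if x ≤ᵇ K then f x else 0#) (interval 1 (K + d)) ≈ ∑ f (interval 1 K)
  ∑-interval-truncate K d f rewrite interval-++ 1 K d = begin
    ∑ g (interval 1 K ++ interval (suc K) d)         ≈⟨ ∑-++ g (interval 1 K) (interval (suc K) d) ⟩
    ∑ g (interval 1 K) ⊕ ∑ g (interval (suc K) d)
      ≈⟨ +-cong (∑-interval-cong 1 K (λ x _ x<1+K → reflexive (cong (if_then f x else 0#) (≤⇒≤ᵇ-true (ℕₚ.<⇒≤pred x<1+K)))))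
                (∑-interval-cong (suc K) d (λ x K<x _ → reflexive (cong (if_then f x else 0#) (<⇒≤ᵇ-false K<x)))) ⟩
    ∑ f (interval 1 K) ⊕ ∑ (λ _ → 0#) (interval (suc K) d) ≈⟨ +-cong ≈-refl (∑-zero (interval (suc K) d)) ⟩
    ∑ f (interval 1 K) ⊕ 0#                          ≈⟨ +-identityʳ _ ⟩
    ∑ f (interval 1 K)                               ∎
    where g = λ x → if x ≤ᵇ K then f x else 0#

  ∑-interval-adjSwap : ∀ a L i (f : ℕ → Carrier) → a ≤ i → suc i < a + L →
                       ∑ f (interval a L) ≈ ∑ (f ∘ adjSwap i) (interval a L)
  ∑-interval-adjSwap a zero i f a≤i 1+i<a =
    ⊥-elim (ℕₚ.<⇒≱ 1+i<a (ℕₚ.≤-trans (ℕₚ.≤-reflexive (ℕₚ.+-identityʳ a)) (ℕₚ.m≤n⇒m≤1+n a≤i)))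
  ∑-interval-adjSwap a (suc L) i f a≤i 1+i<a+L with a ℕₚ.≟ i
  ∑-interval-adjSwap a (suc L) i f a≤i 1+i<a+L | no a≢i =
    +-cong (reflexive (cong f (≡.sym (adjSwap-other a≢i (ℕₚ.<⇒≢ (ℕₚ.<-trans a<i (ℕₚ.n<1+n i)))))))
           (∑-interval-adjSwap (suc a) L i f a<i (subst (suc i <_) (ℕₚ.+-suc a L) 1+i<a+L))
    where a<i = ℕₚ.≤∧≢⇒< a≤i a≢i
  ∑-interval-adjSwap a (suc zero) i f a≤i 1+a<a+1 | yes refl =
    ⊥-elim (ℕₚ.<-irrefl (≡.sym (ℕₚ.+-comm a 1)) 1+a<a+1)
  ∑-interval-adjSwap a (suc (suc L)) i f a≤i 1+i<a+L | yes refl = begin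
    f a ⊕ (f (suc a) ⊕ ∑ f rest)                ≈⟨ sym (+-assoc _ _ _) ⟩
    (f a ⊕ f (suc a)) ⊕ ∑ f rest                ≈⟨ +-cong (+-comm _ _) (∑-interval-cong (suc (suc a)) L fixed) ⟩
    (f (suc a) ⊕ f a) ⊕ ∑ (f ∘ adjSwap a) rest  ≈⟨ +-assoc _ _ _ ⟩
    f (suc a) ⊕ (f a ⊕ ∑ (f ∘ adjSwap a) rest)
      ≈⟨ +-cong (reflexive (cong f (≡.sym (adjSwap-i a)))) (+-cong (reflexive (cong f (≡.sym (adjSwap-1+i a)))) ≈-refl) ⟩
    f (adjSwap a a) ⊕ (f (adjSwap a (suc a)) ⊕ ∑ (f ∘ adjSwap a) rest) ∎
    where
    rest = interval (suc (suc a)) L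
    fixed : ∀ x → suc (suc a) ≤ x → x < suc (suc a) + L → f x ≈ f (adjSwap a x)
    fixed x 2+a≤x _ = reflexive (cong f (≡.sym (adjSwap-other (ℕₚ.>⇒≢ (ℕₚ.<-trans (ℕₚ.n<1+n a) 2+a≤x)) (ℕₚ.>⇒≢ 2+a≤x))))

  ∑-interval-reverse : ∀ L (f : ℕ → Carrier) → ∑ f (interval 1 L) ≈ ∑ (λ y → f (suc L ∸ y)) (interval 1 L)
  ∑-interval-reverse zero    f = ≈-refl
  ∑-interval-reverse (suc L) f = begin
    ∑ f (interval 1 (suc L))                      ≡⟨ cong (∑ f) (interval-∷ʳ 1 L) ⟩
    ∑ f (interval 1 L ++ [ suc L ])               ≈⟨ ∑-++ f (interval 1 L) [ suc L ] ⟩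
    ∑ f (interval 1 L) ⊕ (f (suc L) ⊕ 0#)         ≈⟨ +-cong (∑-interval-reverse L f) (+-identityʳ _) ⟩
    ∑ (λ y → f (suc L ∸ y)) (interval 1 L) ⊕ f (suc L) ≈⟨ +-comm _ _ ⟩
    f (suc L) ⊕ ∑ (λ y → f (suc L ∸ y)) (interval 1 L)
      ≡⟨ cong (f (suc L) ⊕_) (≡.sym (∑-interval-suc 1 L (λ y → f (suc (suc L) ∸ y)))) ⟩
    f (suc L) ⊕ ∑ (λ y → f (suc (suc L) ∸ y)) (interval 2 L) ∎

module Enumerations {c ℓ} (R : CommutativeSemiring c ℓ) where

  open CommutativeSemiring R hiding (zero) renaming (_+_ to _⊕_; _*_ to _⊛_; refl to ≈-refl)
  open Sums R
  open import Relation.Binary.Reasoning.Setoid setoid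

  ∑-words-∷ : ∀ k N (G : List ℕ → Carrier) →
              ∑ G (words (suc k) N) ≈ ∑ (λ a → ∑ (λ w → G (a ∷ w)) (words k N)) (interval 1 N)
  ∑-words-∷ k N G rewrite range≡interval 1 N = ∑-concatMap-map G _∷_ (interval 1 N) (words k N)

  ∑-words-∷ʳ : ∀ k N (G : List ℕ → Carrier) →
               ∑ G (words (suc k) N) ≈ ∑ (λ w → ∑ (λ x → G (w ∷ʳ x)) (interval 1 N)) (words k N)
  ∑-words-∷ʳ zero N G = begin
    ∑ G (words 1 N)                                  ≈⟨ ∑-words-∷ zero N G ⟩
    ∑ (λ a → G [ a ] ⊕ 0#) (interval 1 N)            ≈⟨ ∑-cong (interval 1 N) (λ a → +-identityʳ _) ⟩
    ∑ (λ a → G [ a ]) (interval 1 N)                 ≈⟨ sym (+-identityʳ _) ⟩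
    ∑ (λ a → G [ a ]) (interval 1 N) ⊕ 0#            ∎
  ∑-words-∷ʳ (suc k) N G = begin
    ∑ G (words (suc (suc k)) N)                      ≈⟨ ∑-words-∷ (suc k) N G ⟩
    ∑ (λ a → ∑ (λ w → G (a ∷ w)) (words (suc k) N)) (interval 1 N)
      ≈⟨ ∑-cong (interval 1 N) (λ a → ∑-words-∷ʳ k N (λ w → G (a ∷ w))) ⟩
    ∑ (λ a → ∑ (λ w → ∑ (λ x → G (a ∷ (w ∷ʳ x))) (interval 1 N)) (words k N)) (interval 1 N)
      ≈⟨ sym (∑-words-∷ k N (λ w → ∑ (λ x → G (w ∷ʳ x)) (interval 1 N))) ⟩
    ∑ (λ w → ∑ (λ x → G (w ∷ʳ x)) (interval 1 N)) (words (suc k) N) ∎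

  ∑-words-cong : ∀ k N {F F′ : List ℕ → Carrier} → (∀ w → length w ≡ k → F w ≈ F′ w) → ∑ F (words k N) ≈ ∑ F′ (words k N)
  ∑-words-cong zero    N eq = +-cong (eq [] refl) ≈-refl
  ∑-words-cong (suc k) N {F} {F′} eq = begin
    ∑ F (words (suc k) N)                                    ≈⟨ ∑-words-∷ k N F ⟩
    ∑ (λ a → ∑ (λ w → F (a ∷ w)) (words k N)) (interval 1 N)
      ≈⟨ ∑-cong (interval 1 N) (λ a → ∑-words-cong k N (λ w len≡ → eq (a ∷ w) (cong suc len≡))) ⟩
    ∑ (λ a → ∑ (λ w → F′ (a ∷ w)) (words k N)) (interval 1 N) ≈⟨ sym (∑-words-∷ k N F′) ⟩
    ∑ F′ (words (suc k) N)                                   ∎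

  ∑-words-avoiding : ∀ k N x (G : List ℕ → Carrier) → 1 ≤ x → x ≤ suc N →
    ∑ (λ w → if occurs x w then 0# else G w) (words k (suc N)) ≈ ∑ (G ∘ map (punchIn x)) (words k N)
  ∑-words-avoiding zero    N x G 1≤x x≤1+N = ≈-refl
  ∑-words-avoiding (suc k) N x G 1≤x x≤1+N = begin
    ∑ F (words (suc k) (suc N))                                        ≈⟨ ∑-words-∷ k (suc N) F ⟩
    ∑ (λ a → ∑ (λ w → F (a ∷ w)) (words k (suc N))) (interval 1 (suc N)) ≈⟨ ∑-cong (interval 1 (suc N)) first-letter ⟩
    ∑ (λ a → if a ≡ᵇ x then 0# else K a) (interval 1 (suc N))           ≈⟨ ∑-interval-punchIn N 1 x K 1≤x x≤1+N ⟩
    ∑ (K ∘ punchIn x) (interval 1 N)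
      ≈⟨ ∑-cong (interval 1 N) (λ b → ∑-words-avoiding k N x (λ w → G (punchIn x b ∷ w)) 1≤x x≤1+N) ⟩
    ∑ (λ b → ∑ (λ w → G (punchIn x b ∷ map (punchIn x) w)) (words k N)) (interval 1 N)
      ≈⟨ sym (∑-words-∷ k N (G ∘ map (punchIn x))) ⟩
    ∑ (G ∘ map (punchIn x)) (words (suc k) N)                           ∎
    where
    F = λ w → if occurs x w then 0# else G w
    K = λ a → ∑ (λ w → if occurs x w then 0# else G (a ∷ w)) (words k (suc N))
    first-letter : ∀ a → ∑ (λ w → F (a ∷ w)) (words k (suc N)) ≈ (if a ≡ᵇ x then 0# else K a)
    first-letter a rewrite ≡ᵇ-sym a x with x ≡ᵇ a
    ... | true  = ∑-zero (words k (suc N))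
    ... | false = ≈-refl

  ∑-distinct-words : ∀ n (G : List ℕ → Carrier) →
    ∑ (λ w → if distinct w then G w else 0#) (words n n) ≈ ∑ G (permsByInsertion n)
  ∑-distinct-words zero    G = ≈-refl
  ∑-distinct-words (suc n) G = begin
    ∑ D (words (suc n) (suc n))                                                 ≈⟨ ∑-words-∷ʳ n (suc n) D ⟩
    ∑ (λ w → ∑ (λ x → D (w ∷ʳ x)) (interval 1 (suc n))) (words n (suc n))
      ≈⟨ ∑-cong (words n (suc n)) (λ w → ∑-cong (interval 1 (suc n)) (last-letter w)) ⟩
    ∑ (λ w → ∑ (λ x → if occurs x w then 0# else E x w) (interval 1 (suc n))) (words n (suc n))
      ≈⟨ ∑-comm _ (words n (suc n)) (interval 1 (suc n)) ⟩
    ∑ (λ x → ∑ (λ w → if occurs x w then 0# else E x w) (words n (suc n))) (interval 1 (suc n))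
      ≈⟨ ∑-interval-cong 1 (suc n) (λ x 1≤x x<2+n → ∑-words-avoiding n n x (E x) 1≤x (ℕₚ.≤-pred x<2+n)) ⟩
    ∑ (λ x → ∑ (λ w → E x (map (punchIn x) w)) (words n n)) (interval 1 (suc n))
      ≈⟨ ∑-cong (interval 1 (suc n)) (λ x → ∑-cong (words n n) (λ w →
           reflexive (cong (if_then G (extend w x) else 0#) (distinct-punchIn x w)))) ⟩
    ∑ (λ x → ∑ (λ w → if distinct w then G (extend w x) else 0#) (words n n)) (interval 1 (suc n))
      ≈⟨ ∑-cong (interval 1 (suc n)) (λ x → ∑-distinct-words n (λ π → G (extend π x))) ⟩
    ∑ (λ x → ∑ (λ π → G (extend π x)) (permsByInsertion n)) (interval 1 (suc n))
      ≈⟨ sym (∑-comm (λ π x → G (extend π x)) (permsByInsertion n) (interval 1 (suc n))) ⟩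
    ∑ (λ π → ∑ (G ∘ extend π) (interval 1 (suc n))) (permsByInsertion n)
      ≈⟨ sym (∑-concatMap-map G extend (permsByInsertion n) (interval 1 (suc n))) ⟩
    ∑ G (permsByInsertion (suc n))                                              ∎
    where
    D = λ w → if distinct w then G w else 0#
    E = λ x w → if distinct w then G (w ∷ʳ x) else 0#
    last-letter : ∀ w x → D (w ∷ʳ x) ≈ (if occurs x w then 0# else E x w)
    last-letter w x rewrite distinct-∷ʳ w x with distinct w | occurs x w
    ... | true  | true  = ≈-refl
    ... | true  | false = ≈-refl
    ... | false | true  = ≈-refl
    ... | false | false = ≈-refl

  ∑-perms : ∀ n (G : List ℕ → Carrier) → ∑ G (perms n) ≈ ∑ G (permsByInsertion n)
  ∑-perms n G = trans (∑-filter distinct G (words n n)) (∑-distinct-words n G)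

  ∑-invTable-words : ∀ k N (G : List ℕ → Carrier) → k ≤ N →
    ∑ (λ w → if isInvTable w then G w else 0#) (words k N) ≈ ∑ G (tablesByAppending k)
  ∑-invTable-words zero    N G _   = ≈-refl
  ∑-invTable-words (suc k) N G k<N = begin
    ∑ I (words (suc k) N)                                          ≈⟨ ∑-words-∷ʳ k N I ⟩
    ∑ (λ w → ∑ (λ x → I (w ∷ʳ x)) (interval 1 N)) (words k N)      ≈⟨ ∑-words-cong k N last-entry ⟩
    ∑ (λ w → if isInvTable w then G′ w else 0#) (words k N)        ≈⟨ ∑-invTable-words k N G′ (ℕₚ.<⇒≤ k<N) ⟩
    ∑ G′ (tablesByAppending k)                                     ≈⟨ sym (∑-concatMap-map G _∷ʳ_ (tablesByAppending k) (interval 1 (suc k))) ⟩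
    ∑ G (tablesByAppending (suc k))                                ∎
    where
    I  = λ w → if isInvTable w then G w else 0#
    G′ = λ w → ∑ (λ x → G (w ∷ʳ x)) (interval 1 (suc k))
    restrict : ∀ w b → ∑ (λ x → if b ∧ (x ≤ᵇ suc k) then G (w ∷ʳ x) else 0#) (interval 1 N) ≈ (if b then G′ w else 0#)
    restrict w false = ∑-zero (interval 1 N)
    restrict w true  = trans
      (reflexive (cong (λ l → ∑ (λ x → if x ≤ᵇ suc k then G (w ∷ʳ x) else 0#) (interval 1 l)) (≡.sym (ℕₚ.m+[n∸m]≡n k<N))))
                             (∑-interval-truncate (suc k) (N ∸ suc k) (λ x → G (w ∷ʳ x)))
    last-entry : ∀ w → length w ≡ k → ∑ (λ x → I (w ∷ʳ x)) (interval 1 N) ≈ (if isInvTable w then G′ w else 0#)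
    last-entry w refl = trans
      (∑-interval-cong 1 N (λ x 1≤x _ → reflexive (cong (if_then G (w ∷ʳ x) else 0#)
         (≡.trans (isInvTable-∷ʳ w x) (cong (λ b → isInvTable w ∧ (b ∧ (x ≤ᵇ suc (length w)))) (≤⇒≤ᵇ-true 1≤x))))))
      (restrict w (isInvTable w))

  ∑-invTables : ∀ n (G : List ℕ → Carrier) → ∑ G (invTables n) ≈ ∑ G (tablesByAppending n)
  ∑-invTables n G = trans (∑-filter isInvTable G (words n n)) (∑-invTable-words n n G ℕₚ.≤-refl)

-- The table-side generating function

tableExtensions : ℕ → ℕ → List (List ℕ)
tableExtensions n zero    = [] ∷ []
tableExtensions n (suc k) = concatMap (λ y → map (y ∷_) (tableExtensions (suc n) k)) (interval 1 (suc n))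

module TableGF {c ℓ} (R : CommutativeSemiring c ℓ) (u : ℕ → CommutativeSemiring.Carrier R)
               (v : CommutativeSemiring.Carrier R) where

  open CommutativeSemiring R hiding (zero) renaming (_+_ to _⊕_; _*_ to _⊛_; refl to ≈-refl)
  open Sums R
  open import Algebra.Properties.CommutativeSemigroup *-commutativeSemigroup using (x∙yz≈y∙xz)
  open import Relation.Binary.Reasoning.Setoid setoid

  ascentWeight : ℕ → ℕ → ℕ → Carrier
  ascentWeight m y n = if m <ᵇ y then u n else 1#

  newValueWeight : (ℕ → Bool) → ℕ → Carrier
  newValueWeight U y = if U y then 1# else v

  -- The weight gained by appending s to a table of length n with last entry m and set of values U.
  extensionWeight : (ℕ → Bool) → ℕ → ℕ → List ℕ → Carrier
  extensionWeight U m n []      = 1#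
  extensionWeight U m n (y ∷ s) = ascentWeight m y n ⊛ (newValueWeight U y ⊛ extensionWeight (mark U y) y (suc n) s)

  tableGF : (ℕ → Bool) → ℕ → ℕ → ℕ → Carrier
  tableGF U m n k = ∑ (extensionWeight U m n) (tableExtensions n k)

  extensionWeight-cong : ∀ {U U′} m n s → (∀ z → U z ≡ U′ z) → extensionWeight U m n s ≈ extensionWeight U′ m n s
  extensionWeight-cong m n []      eq = ≈-refl
  extensionWeight-cong m n (y ∷ s) eq = *-cong ≈-refl
    (*-cong (reflexive (cong (if_then 1# else v) (eq y))) (extensionWeight-cong y (suc n) s (mark-cong y eq)))

  tableGF-cong : ∀ {U U′} m n k → (∀ z → U z ≡ U′ z) → tableGF U m n k ≈ tableGF U′ m n k
  tableGF-cong m n k eq = ∑-cong (tableExtensions n k) (λ s → extensionWeight-cong m n s eq)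

  tableGF-suc : ∀ U m n k → tableGF U m n (suc k) ≈
    ∑ (λ y → ascentWeight m y n ⊛ (newValueWeight U y ⊛ tableGF (mark U y) y (suc n) k)) (interval 1 (suc n))
  tableGF-suc U m n k = trans (∑-concatMap-map (extensionWeight U m n) _∷_ (interval 1 (suc n)) S)
    (∑-cong (interval 1 (suc n)) (λ y → sym (trans (*-cong ≈-refl (*-distribˡ-∑ _ _ S)) (*-distribˡ-∑ _ _ S))))
    where S = tableExtensions (suc n) k

  ∑-tableExtensions-adjSwap : ∀ k n i (G : List ℕ → Carrier) → 1 ≤ i → i ≤ n →
    ∑ G (tableExtensions n k) ≈ ∑ (G ∘ map (adjSwap i)) (tableExtensions n k)
  ∑-tableExtensions-adjSwap zero    n i G 1≤i i≤n = ≈-refl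
  ∑-tableExtensions-adjSwap (suc k) n i G 1≤i i≤n = begin
    ∑ G (concatMap (λ y → map (y ∷_) S) (interval 1 (suc n)))     ≈⟨ ∑-concatMap-map G _∷_ (interval 1 (suc n)) S ⟩
    ∑ (λ y → ∑ (λ s → G (y ∷ s)) S) (interval 1 (suc n))
      ≈⟨ ∑-interval-adjSwap 1 (suc n) i (λ y → ∑ (λ s → G (y ∷ s)) S) 1≤i (s≤s (s≤s i≤n)) ⟩
    ∑ (λ y → ∑ (λ s → G (adjSwap i y ∷ s)) S) (interval 1 (suc n))
      ≈⟨ ∑-cong (interval 1 (suc n)) (λ y →
           ∑-tableExtensions-adjSwap k (suc n) i (λ s → G (adjSwap i y ∷ s)) 1≤i (ℕₚ.m≤n⇒m≤1+n i≤n)) ⟩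
    ∑ (λ y → ∑ (λ s → G (adjSwap i y ∷ map (adjSwap i) s)) S) (interval 1 (suc n))
      ≈⟨ sym (∑-concatMap-map (G ∘ map (adjSwap i)) _∷_ (interval 1 (suc n)) S) ⟩
    ∑ (G ∘ map (adjSwap i)) (concatMap (λ y → map (y ∷_) S) (interval 1 (suc n))) ∎
    where S = tableExtensions (suc n) k

  extensionWeight-adjSwap : ∀ i {j} → j ≡ i ⊎ j ≡ suc i → ∀ U m n s → m ≢ j → occurs j s ≡ false →
    extensionWeight U m n s ≈ extensionWeight (U ∘ adjSwap i) (adjSwap i m) n (map (adjSwap i) s)
  extensionWeight-adjSwap i j∈ U m n []      m≢j j∉s   = ≈-refl
  extensionWeight-adjSwap i j∈ U m n (y ∷ s) m≢j j∉y∷s =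
    *-cong (reflexive (cong (if_then u n else 1#) (adjSwap-<ᵇ i m y j∈ m≢j y≢j)))
      (*-cong (reflexive (cong (λ z → if U z then 1# else v) (≡.sym (adjSwap-involutive i y))))
        (trans (extensionWeight-adjSwap i j∈ (mark U y) y (suc n) s y≢j j∉s)
               (extensionWeight-cong (adjSwap i y) (suc n) (map (adjSwap i) s)
                 (λ z → cong (if_then true else U (adjSwap i z)) (adjSwap-≡ᵇ i z y)))))
    where
    y≢j = ≡ᵇ-false⇒≢ (Boolₚ.∨-conicalˡ _ _ j∉y∷s) ∘ ≡.sym
    j∉s = Boolₚ.∨-conicalʳ _ _ j∉y∷s

  private
    unmarked-at-first : ∀ {W W′ : ℕ → Bool} {p} m n s → W p ≡ false → W′ p ≡ true → (∀ z → z ≢ p → W′ z ≡ W z) →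
      extensionWeight W m n (p ∷ s) ≈ v ⊛ extensionWeight W′ m n (p ∷ s)
    unmarked-at-first {W} {W′} {p} m n s Wp W′p agree = begin
      ascentWeight m p n ⊛ (newValueWeight W p ⊛ X)  ≈⟨ *-cong ≈-refl (*-cong (reflexive (cong (if_then 1# else v) Wp)) X≈X′) ⟩
      ascentWeight m p n ⊛ (v ⊛ X′)                  ≈⟨ x∙yz≈y∙xz _ _ _ ⟩
      v ⊛ (ascentWeight m p n ⊛ X′)                  ≈⟨ *-cong ≈-refl (*-cong ≈-refl (sym (*-identityˡ _))) ⟩
      v ⊛ (ascentWeight m p n ⊛ (1# ⊛ X′))
        ≈⟨ *-cong ≈-refl (*-cong ≈-refl (*-cong (reflexive (cong (if_then 1# else v) (≡.sym W′p))) ≈-refl)) ⟩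
      v ⊛ (ascentWeight m p n ⊛ (newValueWeight W′ p ⊛ X′)) ∎
      where
      X  = extensionWeight (mark W p) p (suc n) s
      X′ = extensionWeight (mark W′ p) p (suc n) s
      marked-agree : ∀ z → mark W p z ≡ mark W′ p z
      marked-agree z with z ℕₚ.≟ p
      ... | yes refl = ≡.trans (mark-self W z) (≡.sym (mark-self W′ z))
      ... | no z≢p   = ≡.sym (mark-agree p agree z z≢p)
      X≈X′ : X ≈ X′
      X≈X′ = extensionWeight-cong p (suc n) s marked-agree

  -- The first occurrence of p in s is the only place where the marks of p enter the weight.
  extensionWeight-unmarked : ∀ {W W′ : ℕ → Bool} {p} m n s → W p ≡ false → W′ p ≡ true →
    (∀ z → z ≢ p → W′ z ≡ W z) → occurs p s ≡ true → extensionWeight W m n s ≈ v ⊛ extensionWeight W′ m n s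
  extensionWeight-unmarked {W} {W′} {p} m n (y ∷ s) Wp W′p agree p∈y∷s with y ℕₚ.≟ p
  ... | yes refl = unmarked-at-first m n s Wp W′p agree
  ... | no y≢p = begin
    ascentWeight m y n ⊛ (newValueWeight W y ⊛ X)
      ≈⟨ *-cong ≈-refl (*-cong (reflexive (cong (if_then 1# else v) (≡.sym (agree y y≢p)))) X≈vX′) ⟩
    ascentWeight m y n ⊛ (newValueWeight W′ y ⊛ (v ⊛ X′)) ≈⟨ *-cong ≈-refl (x∙yz≈y∙xz _ _ _) ⟩
    ascentWeight m y n ⊛ (v ⊛ (newValueWeight W′ y ⊛ X′)) ≈⟨ x∙yz≈y∙xz _ _ _ ⟩
    v ⊛ (ascentWeight m y n ⊛ (newValueWeight W′ y ⊛ X′)) ∎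
    where
    X  = extensionWeight (mark W y) y (suc n) s
    X′ = extensionWeight (mark W′ y) y (suc n) s
    p≢y = y≢p ∘ ≡.sym
    X≈vX′ : X ≈ v ⊛ X′
    X≈vX′ = extensionWeight-unmarked y (suc n) s (≡.trans (mark-≢ W p≢y) Wp) (≡.trans (mark-≢ W′ p≢y) W′p)
      (mark-agree y agree) (≡.trans (≡.sym (occurs-∷ s p≢y)) p∈y∷s)

  private
    exchange-at-first : ∀ {U V : ℕ → Bool} {p q} m n s → p ≢ q → U p ≡ true → U q ≡ false → V p ≡ false → V q ≡ true →
      (∀ z → z ≢ p → z ≢ q → V z ≡ U z) → occurs q s ≡ true → extensionWeight U m n (p ∷ s) ≈ extensionWeight V m n (p ∷ s)
    exchange-at-first {U} {V} {p} {q} m n s p≢q Up Uq Vp Vq agree q∈s = *-cong ≈-refl (begin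
      newValueWeight U p ⊛ X ≈⟨ *-cong (reflexive (cong (if_then 1# else v) Up)) ≈-refl ⟩
      1# ⊛ X                 ≈⟨ *-identityˡ _ ⟩
      X                      ≈⟨ extensionWeight-unmarked p (suc n) s (≡.trans (mark-≢ U q≢p) Uq) (≡.trans (mark-≢ V q≢p) Vq) agreeᵐ q∈s ⟩
      v ⊛ Y                  ≈⟨ *-cong (reflexive (cong (if_then 1# else v) (≡.sym Vp))) ≈-refl ⟩
      newValueWeight V p ⊛ Y ∎)
      where
      X = extensionWeight (mark U p) p (suc n) s
      Y = extensionWeight (mark V p) p (suc n) s
      q≢p = p≢q ∘ ≡.sym
      agreeᵐ : ∀ z → z ≢ q → mark V p z ≡ mark U p z
      agreeᵐ z z≢q with z ℕₚ.≟ p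
      ... | yes refl = ≡.trans (mark-self V z) (≡.sym (mark-self U z))
      ... | no z≢p   = cong (if z ≡ᵇ p then true else_) (agree z z≢p z≢q)

  -- Whichever of p and q comes first in s is new for exactly one of U and V.
  extensionWeight-exchange : ∀ {U V : ℕ → Bool} {p q} m n s → p ≢ q → U p ≡ true → U q ≡ false → V p ≡ false → V q ≡ true →
    (∀ z → z ≢ p → z ≢ q → V z ≡ U z) → occurs p s ≡ true → occurs q s ≡ true →
    extensionWeight U m n s ≈ extensionWeight V m n s
  extensionWeight-exchange {U} {V} {p} {q} m n (y ∷ s) p≢q Up Uq Vp Vq agree p∈y∷s q∈y∷s with y ℕₚ.≟ p | y ℕₚ.≟ q
  ... | yes refl | _        = exchange-at-first m n s p≢q Up Uq Vp Vq agree (≡.trans (≡.sym (occurs-∷ s (p≢q ∘ ≡.sym))) q∈y∷s)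
  ... | no _     | yes refl = sym (exchange-at-first m n s (p≢q ∘ ≡.sym) Vq Vp Uq Up (λ z z≢q z≢p → ≡.sym (agree z z≢p z≢q))
                                    (≡.trans (≡.sym (occurs-∷ s p≢q)) p∈y∷s))
  ... | no y≢p   | no y≢q   = *-cong ≈-refl
    (*-cong (reflexive (cong (if_then 1# else v) (≡.sym (agree y y≢p y≢q))))
      (extensionWeight-exchange y (suc n) s p≢q
        (≡.trans (mark-≢ U p≢y) Up) (≡.trans (mark-≢ U q≢y) Uq) (≡.trans (mark-≢ V p≢y) Vp) (≡.trans (mark-≢ V q≢y) Vq)
        (λ z z≢p z≢q → cong (if z ≡ᵇ y then true else_) (agree z z≢p z≢q))
        (≡.trans (≡.sym (occurs-∷ s p≢y)) p∈y∷s) (≡.trans (≡.sym (occurs-∷ s q≢y)) q∈y∷s)))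
    where
    p≢y = y≢p ∘ ≡.sym
    q≢y = y≢q ∘ ≡.sym

  extensionWeight-map-adjSwap : ∀ U m n s i {j} → j ≡ i ⊎ j ≡ suc i → m ≢ i → m ≢ suc i → occurs j s ≡ false →
    extensionWeight U m n s ≈ extensionWeight (U ∘ adjSwap i) m n (map (adjSwap i) s)
  extensionWeight-map-adjSwap U m n s i j∈ m≢i m≢1+i j∉s = trans
    (extensionWeight-adjSwap i j∈ U m n s (m≢j j∈) j∉s)
    (reflexive (cong (λ m′ → extensionWeight (U ∘ adjSwap i) m′ n (map (adjSwap i) s)) (adjSwap-other m≢i m≢1+i)))
    where
    m≢j : ∀ {j} → j ≡ i ⊎ j ≡ suc i → m ≢ j
    m≢j (inj₁ refl) = m≢i
    m≢j (inj₂ refl) = m≢1+i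

  extensionWeight-both : ∀ U m n s i → occurs i s ≡ true → occurs (suc i) s ≡ true →
    extensionWeight U m n s ≈ extensionWeight (U ∘ adjSwap i) m n s
  extensionWeight-both U m n s i i∈s 1+i∈s with U i in Ui | U (suc i) in U1+i
  ... | true  | false = extensionWeight-exchange m n s (ℕₚ.1+n≢n ∘ ≡.sym) Ui U1+i (≡.trans (cong U (adjSwap-i i)) U1+i)
                          (≡.trans (cong U (adjSwap-1+i i)) Ui) (λ z z≢i z≢1+i → cong U (adjSwap-other z≢i z≢1+i)) i∈s 1+i∈s
  ... | false | true  = sym (extensionWeight-exchange m n s (ℕₚ.1+n≢n ∘ ≡.sym) (≡.trans (cong U (adjSwap-i i)) U1+i)
                          (≡.trans (cong U (adjSwap-1+i i)) Ui) Ui U1+i (λ z z≢i z≢1+i → cong U (≡.sym (adjSwap-other z≢i z≢1+i))) i∈s 1+i∈s)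
  ... | true  | true  = extensionWeight-cong m n s (adjSwap-invariant U i (≡.trans Ui (≡.sym U1+i)))
  ... | false | false = extensionWeight-cong m n s (adjSwap-invariant U i (≡.trans Ui (≡.sym U1+i)))

  -- Split the extensions by whether they contain both i and i + 1: adjSwap i permutes those that do not,
  -- and fixes the weight of those that do.
  tableGF-adjSwap : ∀ U m n k i → 1 ≤ i → i ≤ n → m ≢ i → m ≢ suc i → tableGF U m n k ≈ tableGF (U ∘ adjSwap i) m n k
  tableGF-adjSwap U m n k i 1≤i i≤n m≢i m≢1+i = begin
    ∑ fU S                                          ≈⟨ ∑-cong S (λ s → split (both s) (fU s)) ⟩
    ∑ (λ s → withoutBoth fU s ⊕ withBoth fU s) S    ≈⟨ ∑-distrib-+ (withoutBoth fU) (withBoth fU) S ⟩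
    ∑ (withoutBoth fU) S ⊕ ∑ (withBoth fU) S
      ≈⟨ +-cong (trans (∑-tableExtensions-adjSwap k n i (withoutBoth fU) 1≤i i≤n) (∑-cong S neither)) (∑-cong S both-cases) ⟩
    ∑ (withoutBoth fV) S ⊕ ∑ (withBoth fV) S        ≈⟨ sym (∑-distrib-+ (withoutBoth fV) (withBoth fV) S) ⟩
    ∑ (λ s → withoutBoth fV s ⊕ withBoth fV s) S    ≈⟨ sym (∑-cong S (λ s → split (both s) (fV s))) ⟩
    ∑ fV S                                          ∎
    where
    S  = tableExtensions n k
    fU = extensionWeight U m n
    fV = extensionWeight (U ∘ adjSwap i) m n
    sw = map (adjSwap i)
    both : List ℕ → Bool
    both s = occurs i s ∧ occurs (suc i) s
    withoutBoth withBoth : (List ℕ → Carrier) → List ℕ → Carrier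
    withoutBoth f s = if both s then 0# else f s
    withBoth    f s = if both s then f s else 0#
    split : ∀ b X → X ≈ (if b then 0# else X) ⊕ (if b then X else 0#)
    split false X = sym (+-identityʳ X)
    split true  X = sym (+-identityˡ X)
    occurs-i-sw : ∀ s → occurs i (sw s) ≡ occurs (suc i) s
    occurs-i-sw s = ≡.trans (occurs-adjSwap i i s) (cong (λ z → occurs z s) (adjSwap-i i))
    occurs-1+i-sw : ∀ s → occurs (suc i) (sw s) ≡ occurs i s
    occurs-1+i-sw s = ≡.trans (occurs-adjSwap i (suc i) s) (cong (λ z → occurs z s) (adjSwap-1+i i))
    swapped : ∀ {j} → j ≡ i ⊎ j ≡ suc i → ∀ s → occurs j (sw s) ≡ false → fU (sw s) ≈ fV s
    swapped j∈ s j∉ = trans (extensionWeight-map-adjSwap U m n (sw s) i j∈ m≢i m≢1+i j∉)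
                            (reflexive (cong fV (map-adjSwap-involutive i s)))
    neither : ∀ s → withoutBoth fU (sw s) ≈ withoutBoth fV s
    neither s rewrite occurs-i-sw s | occurs-1+i-sw s | Boolₚ.∧-comm (occurs (suc i) s) (occurs i s)
      with occurs i s in i∈s | occurs (suc i) s in 1+i∈s
    ... | true  | true  = ≈-refl
    ... | false | _     = swapped (inj₂ refl) s (≡.trans (occurs-1+i-sw s) i∈s)
    ... | true  | false = swapped (inj₁ refl) s (≡.trans (occurs-i-sw s) 1+i∈s)
    both-cases : ∀ s → withBoth fU s ≈ withBoth fV s
    both-cases s with occurs i s in i∈s | occurs (suc i) s in 1+i∈s
    ... | true  | true  = extensionWeight-both U m n s i i∈s 1+i∈s
    ... | true  | false = ≈-refl
    ... | false | _     = ≈-refl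

  -- The gap is carried past n + 1 by adjacent swaps, none of which involves the last entry y.
  tableGF-insertGap : ∀ d p V y n k → y < p → p + d ≤ suc n → (∀ z → p + d ≤ z → V z ≡ false) →
                      tableGF (insertGap p V) y n k ≈ tableGF V y n k
  tableGF-insertGap zero p V y n k y<p p≤1+n V≥p =
    tableGF-cong y n k (insertGap-beyond p V (λ z p≤z → V≥p z (subst (_≤ z) (≡.sym (ℕₚ.+-identityʳ p)) p≤z)))
  tableGF-insertGap (suc d) p V y n k y<p p+d≤1+n V≥p+d = begin
    tableGF (insertGap p V) y n k                         ≈⟨ tableGF-cong y n k (insertGap-adjSwap p V) ⟩
    tableGF (insertGap (suc p) V ∘ adjSwap p) y n k
      ≈⟨ sym (tableGF-adjSwap (insertGap (suc p) V) y n k p (ℕₚ.≤-trans (s≤s z≤n) y<p) p≤n (ℕₚ.<⇒≢ y<p)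
                              (ℕₚ.<⇒≢ (ℕₚ.<-trans y<p (ℕₚ.n<1+n p)))) ⟩
    tableGF (insertGap (suc p) V) y n k
      ≈⟨ tableGF-insertGap d (suc p) V y n k (ℕₚ.<-trans y<p (ℕₚ.n<1+n p)) 1+p+d≤1+n
                           (λ z le → V≥p+d z (subst (_≤ z) (≡.sym (ℕₚ.+-suc p d)) le)) ⟩
    tableGF V y n k ∎
    where
    1+p+d≤1+n = subst (_≤ suc n) (ℕₚ.+-suc p d) p+d≤1+n
    p≤n = ℕₚ.≤-pred (ℕₚ.≤-trans (ℕₚ.m≤m+n (suc p) d) 1+p+d≤1+n)

-- The permutation-side generating function

module PermGF {c ℓ} (R : CommutativeSemiring c ℓ) (u : ℕ → CommutativeSemiring.Carrier R)
              (v : CommutativeSemiring.Carrier R) where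

  open CommutativeSemiring R hiding (zero) renaming (_+_ to _⊕_; _*_ to _⊛_; refl to ≈-refl)
  open Sums R
  open TableGF R u v
  open import Relation.Binary.Reasoning.Setoid setoid

  descentWeight : ℕ → ℕ → ℕ → Carrier
  descentWeight x m n = if x ≤ᵇ m then u n else 1#

  ideWeight : (ℕ → Bool) → ℕ → Carrier
  ideWeight B x = if B (x ∸ 1) then 1# else v

  -- Weighted count of k further insertions into a permutation of length n with last letter m and flags B.
  permGF : (ℕ → Bool) → ℕ → ℕ → ℕ → Carrier
  permGF B m n zero    = 1#
  permGF B m n (suc k) = ∑ (λ x → descentWeight x m n ⊛ (ideWeight B x ⊛ permGF (insertFlag x B) x (suc n) k)) (interval 1 (suc n))

  permGF-cong : ∀ k {B B′} m n → (∀ j → B j ≡ B′ j) → permGF B m n k ≈ permGF B′ m n k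
  permGF-cong zero    m n eq = ≈-refl
  permGF-cong (suc k) {B} {B′} m n eq = ∑-cong (interval 1 (suc n)) λ x →
    *-cong ≈-refl (*-cong (reflexive (cong (if_then 1# else v) (eq (x ∸ 1)))) (permGF-cong k x (suc n) (insertFlag-cong x)))
    where
    insertFlag-cong : ∀ x j → insertFlag x B j ≡ insertFlag x B′ j
    insertFlag-cong x j rewrite eq j | eq (j ∸ 1) = refl

  -- Reflecting the inserted value x ↦ n + 2 − x turns each insertion step into an appending step.
  reflected-step : ∀ k n B m → B 0 ≡ false → m ≤ suc n → ∀ y → 1 ≤ y → y < 1 + suc n →
    descentWeight (suc (suc n) ∸ y) m n ⊛ (ideWeight B (suc (suc n) ∸ y) ⊛
      tableGF (reflectFlags (suc n) (insertFlag (suc (suc n) ∸ y) B)) (suc (suc n) ∸ (suc (suc n) ∸ y)) (suc n) k)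
    ≈ ascentWeight (suc n ∸ m) y n ⊛ (newValueWeight (reflectFlags n B) y ⊛ tableGF (mark (reflectFlags n B) y) y (suc n) k)
  reflected-step k n B m B0 m≤1+n y 1≤y y<2+n =
    *-cong (reflexive (cong (if_then u n else 1#) (≤ᵇ-reflect x y n m x+y≡ 1≤x m≤1+n)))
      (*-cong (reflexive (cong (if_then 1# else v) (reflectFlags-reflect x y n B x+y≡ 1≤x 1≤y)))
        (begin
          tableGF (reflectFlags (suc n) (insertFlag x B)) (suc (suc n) ∸ x) (suc n) k
            ≡⟨ cong (λ w → tableGF (reflectFlags (suc n) (insertFlag x B)) w (suc n) k) (ℕₚ.m∸[m∸n]≡n y≤2+n) ⟩
          tableGF (reflectFlags (suc n) (insertFlag x B)) y (suc n) k
            ≈⟨ tableGF-cong y (suc n) k (reflectFlags-insertFlag n x y B x+y≡ 1≤x 1≤y B0) ⟩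
          tableGF (insertGap (suc y) U′) y (suc n) k
            ≈⟨ tableGF-insertGap (suc n ∸ y) (suc y) U′ y (suc n) k (ℕₚ.n<1+n y) (ℕₚ.≤-reflexive gap-end)
                 (λ z le → unmarked-beyond z (subst (_≤ z) gap-end le)) ⟩
          tableGF U′ y (suc n) k ∎))
    where
    U′ = mark (reflectFlags n B) y
    x = suc (suc n) ∸ y
    y≤2+n = ℕₚ.≤-trans (ℕₚ.≤-pred y<2+n) (ℕₚ.n≤1+n _)
    x+y≡ : x + y ≡ suc (suc n)
    x+y≡ = ℕₚ.m∸n+n≡m y≤2+n
    1≤x : 1 ≤ x
    1≤x = ℕₚ.m+n≤o⇒m≤o∸n 1 y<2+n
    gap-end : suc y + (suc n ∸ y) ≡ suc (suc n)
    gap-end = cong suc (ℕₚ.m+[n∸m]≡n (ℕₚ.≤-pred y<2+n))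
    unmarked-beyond : ∀ z → suc (suc n) ≤ z → U′ z ≡ false
    unmarked-beyond (suc z) (s≤s 1+n≤z) rewrite ≢⇒≡ᵇ-false {suc z} {y} (ℕₚ.>⇒≢ (ℕₚ.≤-trans y<2+n (s≤s 1+n≤z)))
      | ℕₚ.m≤n⇒m∸n≡0 (ℕₚ.≤-trans (ℕₚ.n≤1+n n) 1+n≤z) = B0

  permGF≈tableGF : ∀ k n B m → B 0 ≡ false → m ≤ suc n → permGF B m n k ≈ tableGF (reflectFlags n B) (suc n ∸ m) n k
  permGF≈tableGF zero    n B m B0 m≤1+n = sym (+-identityʳ 1#)
  permGF≈tableGF (suc k) n B m B0 m≤1+n = begin
    ∑ (λ x → descentWeight x m n ⊛ (ideWeight B x ⊛ permGF (insertFlag x B) x (suc n) k)) (interval 1 (suc n))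
      ≈⟨ ∑-interval-cong 1 (suc n) (λ x 1≤x x<2+n → *-cong ≈-refl (*-cong ≈-refl
           (permGF≈tableGF k (suc n) (insertFlag x B) x (insertFlag-zero x B 1≤x B0) (ℕₚ.≤-trans (ℕₚ.≤-pred x<2+n) (ℕₚ.n≤1+n _))))) ⟩
    ∑ G (interval 1 (suc n))                                        ≈⟨ ∑-interval-reverse (suc n) G ⟩
    ∑ (λ y → G (suc (suc n) ∸ y)) (interval 1 (suc n))              ≈⟨ ∑-interval-cong 1 (suc n) (reflected-step k n B m B0 m≤1+n) ⟩
    ∑ (λ y → ascentWeight (suc n ∸ m) y n ⊛ (newValueWeight U y ⊛ tableGF (mark U y) y (suc n) k)) (interval 1 (suc n))
      ≈⟨ sym (tableGF-suc U (suc n ∸ m) n k) ⟩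
    tableGF U (suc n ∸ m) n (suc k)                                  ∎
    where
    U = reflectFlags n B
    G = λ x → descentWeight x m n ⊛ (ideWeight B x ⊛ tableGF (reflectFlags (suc n) (insertFlag x B)) (suc (suc n) ∸ x) (suc n) k)

-- Unfolding the two sums into the generating functions

module Unfolding {c ℓ} (R : CommutativeSemiring c ℓ) (u : ℕ → CommutativeSemiring.Carrier R)
                 (v : CommutativeSemiring.Carrier R) where

  open CommutativeSemiring R hiding (zero) renaming (_+_ to _⊕_; _*_ to _⊛_; refl to ≈-refl)
  open import Algebra.Properties.CommutativeSemigroup *-commutativeSemigroup using () renaming (interchange to *-interchange)
  open import Relation.Binary.Reasoning.Setoid setoid
  open Sums R
  open TableGF R u v
  open PermGF R u v

  permWeight tableWeight : List ℕ → Carrier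
  permWeight  π = monoS R u (DES π) ⊛ pow R v (ides π)
  tableWeight e = monoS R u (ASC e) ⊛ pow R v (row e)

  pow-+ : ∀ a b → pow R v (a + b) ≈ pow R v a ⊛ pow R v b
  pow-+ zero    b = sym (*-identityˡ _)
  pow-+ (suc a) b = trans (*-cong ≈-refl (pow-+ a b)) (sym (*-assoc _ _ _))

  pow-bit-not : ∀ b → pow R v (bit (not b)) ≈ (if b then 1# else v)
  pow-bit-not true  = ≈-refl
  pow-bit-not false = *-identityʳ v

  monoS-positionsWhere : ∀ c w → monoS R u (positionsWhere c w) ≈
    ∏ (λ i → if c (at w i) (at w (suc i)) then u i else 1#) (interval 1 (length w ∸ 1))
  monoS-positionsWhere c w = trans (∏-filter _ u (range 1 (length w ∸ 1))) (reflexive (cong (∏ _) (range≡interval 1 (length w ∸ 1))))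

  monoS-positionsWhere-∷ʳ : ∀ c w x L → length w ≡ suc L →
    monoS R u (positionsWhere c (w ∷ʳ x)) ≈ monoS R u (positionsWhere c w) ⊛ (if c (at w (suc L)) x then u (suc L) else 1#)
  monoS-positionsWhere-∷ʳ c w x L len≡ = begin
    monoS R u (positionsWhere c (w ∷ʳ x))                    ≈⟨ monoS-positionsWhere c (w ∷ʳ x) ⟩
    ∏ f′ (interval 1 (length (w ∷ʳ x) ∸ 1))
      ≡⟨ cong (λ l → ∏ f′ (interval 1 (l ∸ 1))) (≡.trans (length-∷ʳ w x) (cong suc len≡)) ⟩
    ∏ f′ (interval 1 (suc L))                                ≡⟨ cong (∏ f′) (interval-∷ʳ 1 L) ⟩
    ∏ f′ (interval 1 L ++ [ suc L ])                         ≈⟨ ∏-++ f′ (interval 1 L) [ suc L ] ⟩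
    ∏ f′ (interval 1 L) ⊛ (f′ (suc L) ⊛ 1#)
      ≈⟨ *-cong (∏-interval-cong 1 L old-positions) (trans (*-identityʳ _) last-position) ⟩
    ∏ f (interval 1 L) ⊛ (if c (at w (suc L)) x then u (suc L) else 1#)
      ≈⟨ *-cong (sym (trans (monoS-positionsWhere c w) (reflexive (cong (λ l → ∏ f (interval 1 (l ∸ 1))) len≡)))) ≈-refl ⟩
    monoS R u (positionsWhere c w) ⊛ (if c (at w (suc L)) x then u (suc L) else 1#) ∎
    where
    f  = λ i → if c (at w i) (at w (suc i)) then u i else 1#
    f′ = λ i → if c (at (w ∷ʳ x) i) (at (w ∷ʳ x) (suc i)) then u i else 1#
    at-old : ∀ i → 1 ≤ i → i ≤ suc L → at (w ∷ʳ x) i ≡ at w i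
    at-old i 1≤i i≤1+L = at-∷ʳ w x i 1≤i (subst (i ≤_) (≡.sym len≡) i≤1+L)
    old-positions : ∀ i → 1 ≤ i → i < 1 + L → f′ i ≈ f i
    old-positions i 1≤i i<1+L = reflexive (cong (if_then u i else 1#)
      (cong₂ c (at-old i 1≤i (ℕₚ.m≤n⇒m≤1+n (ℕₚ.≤-pred i<1+L))) (at-old (suc i) (s≤s z≤n) i<1+L)))
    last-position : f′ (suc L) ≈ (if c (at w (suc L)) x then u (suc L) else 1#)
    last-position = reflexive (cong (if_then u (suc L) else 1#)
      (cong₂ c (at-old (suc L) (s≤s z≤n) ℕₚ.≤-refl) (≡.trans (cong (λ l → at (w ∷ʳ x) (suc l)) (≡.sym len≡)) (at-last w x))))

  monoS-DES-extend : ∀ π x L → length π ≡ suc L →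
    monoS R u (DES (extend π x)) ≈ monoS R u (DES π) ⊛ descentWeight x (at π (suc L)) (suc L)
  monoS-DES-extend π x L len≡ = trans
    (monoS-positionsWhere-∷ʳ (λ a b → b <ᵇ a) (map (punchIn x) π) x L (≡.trans (Listₚ.length-map (punchIn x) π) len≡))
    (*-cong (reflexive (cong (monoS R u) (positionsWhere-map (λ a b → b <ᵇ a) (punchIn x) π (λ a b → punchIn-<ᵇ x b a))))
            (reflexive (cong (if_then u (suc L) else 1#)
              (≡.trans (cong (x <ᵇ_) (at-map (punchIn x) π (suc L) (s≤s z≤n) (ℕₚ.≤-reflexive (≡.sym len≡)))) (<ᵇ-punchIn x _)))))

  permWeight-extend : ∀ π x L → length π ≡ suc L → 1 ≤ x → x ≤ suc (suc L) → ∀ k →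
    permWeight (extend π x) ⊛ permGF (ideFlag (extend π x)) (at (extend π x) (suc (suc L))) (suc (suc L)) k
      ≈ permWeight π ⊛ (descentWeight x (at π (suc L)) (suc L) ⊛ (ideWeight (ideFlag π) x ⊛ permGF (insertFlag x (ideFlag π)) x (suc (suc L)) k))
  permWeight-extend π x L len≡ 1≤x x≤2+L k = begin
    (monoS R u (DES (extend π x)) ⊛ pow R v (ides (extend π x))) ⊛ permGF (ideFlag (extend π x)) (at (extend π x) (suc (suc L))) (suc (suc L)) k
      ≈⟨ *-cong (*-cong (monoS-DES-extend π x L len≡)
                        (trans (reflexive (cong (pow R v) (ides-extend π x 1≤n 1≤x x≤1+n))) (pow-+ (ides π) _)))
                (trans (reflexive (cong (λ m → permGF (ideFlag (extend π x)) m (suc (suc L)) k) last≡x))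
                       (permGF-cong k x (suc (suc L)) (ideFlag-extend π x 1≤x x≤1+n))) ⟩
    ((monoS R u (DES π) ⊛ dw) ⊛ (pow R v (ides π) ⊛ pow R v (bit (not (ideFlag π (x ∸ 1)))))) ⊛ F
      ≈⟨ trans (*-cong (*-interchange _ _ _ _) ≈-refl) (trans (*-assoc _ _ _) (*-cong ≈-refl (*-assoc _ _ _))) ⟩
    permWeight π ⊛ (dw ⊛ (pow R v (bit (not (ideFlag π (x ∸ 1)))) ⊛ F))
      ≈⟨ *-cong ≈-refl (*-cong ≈-refl (*-cong (pow-bit-not (ideFlag π (x ∸ 1))) ≈-refl)) ⟩
    permWeight π ⊛ (dw ⊛ (ideWeight (ideFlag π) x ⊛ F)) ∎
    where
    dw = descentWeight x (at π (suc L)) (suc L)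
    F  = permGF (insertFlag x (ideFlag π)) x (suc (suc L)) k
    1≤n = subst (1 ≤_) (≡.sym len≡) (s≤s z≤n)
    x≤1+n = subst (λ l → x ≤ suc l) (≡.sym len≡) x≤2+L
    last≡x : at (extend π x) (suc (suc L)) ≡ x
    last≡x = ≡.trans (cong (λ l → at (extend π x) (suc l)) (≡.sym (≡.trans (Listₚ.length-map (punchIn x) π) len≡)))
                     (at-last (map (punchIn x) π) x)

  tableWeight-∷ʳ : ∀ e x L → TableShape (suc L) e → 1 ≤ x → x ≤ suc (suc L) → ∀ k →
    tableWeight (e ∷ʳ x) ⊛ tableGF (λ y → occurs y (e ∷ʳ x)) (at (e ∷ʳ x) (suc (suc L))) (suc (suc L)) k
      ≈ tableWeight e ⊛ (ascentWeight (at e (suc L)) x (suc L) ⊛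
                          (newValueWeight (λ y → occurs y e) x ⊛ tableGF (mark (λ y → occurs y e) x) x (suc (suc L)) k))
  tableWeight-∷ʳ e x L (len≡ , 1∈e , >n∉e) 1≤x x≤2+L k = begin
    (monoS R u (ASC (e ∷ʳ x)) ⊛ pow R v (row (e ∷ʳ x))) ⊛ tableGF (λ y → occurs y (e ∷ʳ x)) (at (e ∷ʳ x) (suc (suc L))) (suc (suc L)) k
      ≈⟨ *-cong (*-cong (monoS-positionsWhere-∷ʳ _<ᵇ_ e x L len≡)
                        (trans (reflexive (cong (pow R v) (row-∷ʳ e x L len≡ (1∈e (s≤s z≤n)) (>n∉e (suc (suc L)) ℕₚ.≤-refl) 1≤x x≤2+L)))
                               (pow-+ (row e) _)))
                (trans (reflexive (cong (λ m → tableGF (λ y → occurs y (e ∷ʳ x)) m (suc (suc L)) k) last≡x))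
                       (tableGF-cong x (suc (suc L)) k occurs-mark)) ⟩
    ((monoS R u (ASC e) ⊛ aw) ⊛ (pow R v (row e) ⊛ pow R v (bit (not (occurs x e))))) ⊛ F
      ≈⟨ trans (*-cong (*-interchange _ _ _ _) ≈-refl) (trans (*-assoc _ _ _) (*-cong ≈-refl (*-assoc _ _ _))) ⟩
    tableWeight e ⊛ (aw ⊛ (pow R v (bit (not (occurs x e))) ⊛ F))
      ≈⟨ *-cong ≈-refl (*-cong ≈-refl (*-cong (pow-bit-not (occurs x e)) ≈-refl)) ⟩
    tableWeight e ⊛ (aw ⊛ (newValueWeight (λ y → occurs y e) x ⊛ F)) ∎
    where
    aw = ascentWeight (at e (suc L)) x (suc L)
    F  = tableGF (mark (λ y → occurs y e) x) x (suc (suc L)) k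
    last≡x : at (e ∷ʳ x) (suc (suc L)) ≡ x
    last≡x = ≡.trans (cong (λ l → at (e ∷ʳ x) (suc l)) (≡.sym len≡)) (at-last e x)
    occurs-mark : ∀ y → occurs y (e ∷ʳ x) ≡ mark (λ y → occurs y e) x y
    occurs-mark y rewrite occurs-∷ʳ y e x with y ≡ᵇ x
    ... | true  = Boolₚ.∨-zeroʳ (occurs y e)
    ... | false = Boolₚ.∨-identityʳ (occurs y e)

  -- Peeling off the last insertion moves one step of the sum into the generating function.
  ∑-permsByInsertion-unfold : ∀ L k →
    ∑ (λ π → permWeight π ⊛ permGF (ideFlag π) (at π (suc L)) (suc L) k) (permsByInsertion (suc L))
      ≈ permGF (ideFlag [ 1 ]) 1 1 (L + k)
  ∑-permsByInsertion-unfold zero    k = trans (+-identityʳ _) (trans (*-cong (*-identityʳ 1#) ≈-refl) (*-identityˡ _))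
  ∑-permsByInsertion-unfold (suc L) k = begin
    ∑ F (permsByInsertion (suc (suc L)))                          ≈⟨ ∑-concatMap-map F extend Ps I ⟩
    ∑ (λ π → ∑ (F ∘ extend π) I) Ps
      ≈⟨ ∑-cong-All (permsByInsertion-length (suc L)) (λ π len≡ →
           ∑-interval-cong 1 (suc (suc L)) (λ x 1≤x x<3+L → permWeight-extend π x L len≡ 1≤x (ℕₚ.≤-pred x<3+L) k)) ⟩
    ∑ (λ π → ∑ (λ x → permWeight π ⊛ step π x) I) Ps
      ≈⟨ ∑-cong Ps (λ π → sym (*-distribˡ-∑ (permWeight π) (step π) I)) ⟩
    ∑ (λ π → permWeight π ⊛ permGF (ideFlag π) (at π (suc L)) (suc L) (suc k)) Ps ≈⟨ ∑-permsByInsertion-unfold L (suc k) ⟩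
    permGF (ideFlag [ 1 ]) 1 1 (L + suc k)                        ≡⟨ cong (permGF (ideFlag [ 1 ]) 1 1) (ℕₚ.+-suc L k) ⟩
    permGF (ideFlag [ 1 ]) 1 1 (suc L + k)                        ∎
    where
    Ps = permsByInsertion (suc L)
    I  = interval 1 (suc (suc L))
    F  = λ π → permWeight π ⊛ permGF (ideFlag π) (at π (suc (suc L))) (suc (suc L)) k
    step = λ π x → descentWeight x (at π (suc L)) (suc L) ⊛ (ideWeight (ideFlag π) x ⊛ permGF (insertFlag x (ideFlag π)) x (suc (suc L)) k)

  ∑-tablesByAppending-unfold : ∀ L k →
    ∑ (λ e → tableWeight e ⊛ tableGF (λ y → occurs y e) (at e (suc L)) (suc L) k) (tablesByAppending (suc L))
      ≈ tableGF (λ y → occurs y [ 1 ]) 1 1 (L + k)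
  ∑-tablesByAppending-unfold zero    k = trans (+-identityʳ _) (trans (*-cong (*-identityʳ 1#) ≈-refl) (*-identityˡ _))
  ∑-tablesByAppending-unfold (suc L) k = begin
    ∑ F (tablesByAppending (suc (suc L)))                         ≈⟨ ∑-concatMap-map F _∷ʳ_ Es I ⟩
    ∑ (λ e → ∑ (F ∘ (e ∷ʳ_)) I) Es
      ≈⟨ ∑-cong-All (tablesByAppending-shape (suc L)) (λ e shape →
           ∑-interval-cong 1 (suc (suc L)) (λ x 1≤x x<3+L → tableWeight-∷ʳ e x L shape 1≤x (ℕₚ.≤-pred x<3+L) k)) ⟩
    ∑ (λ e → ∑ (λ x → tableWeight e ⊛ step e x) I) Es             ≈⟨ ∑-cong Es (λ e → sym (*-distribˡ-∑ (tableWeight e) (step e) I)) ⟩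
    ∑ (λ e → tableWeight e ⊛ ∑ (step e) I) Es
      ≈⟨ ∑-cong Es (λ e → *-cong ≈-refl (sym (tableGF-suc (λ y → occurs y e) (at e (suc L)) (suc L) k))) ⟩
    ∑ (λ e → tableWeight e ⊛ tableGF (λ y → occurs y e) (at e (suc L)) (suc L) (suc k)) Es ≈⟨ ∑-tablesByAppending-unfold L (suc k) ⟩
    tableGF (λ y → occurs y [ 1 ]) 1 1 (L + suc k)               ≡⟨ cong (tableGF (λ y → occurs y [ 1 ]) 1 1) (ℕₚ.+-suc L k) ⟩
    tableGF (λ y → occurs y [ 1 ]) 1 1 (suc L + k)               ∎
    where
    Es = tablesByAppending (suc L)
    I  = interval 1 (suc (suc L))
    F  = λ e → tableWeight e ⊛ tableGF (λ y → occurs y e) (at e (suc (suc L))) (suc (suc L)) k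
    step = λ e x → ascentWeight (at e (suc L)) x (suc L) ⊛
                   (newValueWeight (λ y → occurs y e) x ⊛ tableGF (mark (λ y → occurs y e) x) x (suc (suc L)) k)

  permGF≈tableGF-initial : ∀ j → permGF (ideFlag [ 1 ]) 1 1 j ≈ tableGF (λ y → occurs y [ 1 ]) 1 1 j
  permGF≈tableGF-initial j = trans (permGF≈tableGF j 1 (ideFlag [ 1 ]) 1 refl (s≤s z≤n)) (tableGF-cong 1 1 j initial)
    where
    initial : ∀ z → reflectFlags 1 (ideFlag [ 1 ]) z ≡ occurs z [ 1 ]
    initial zero                = refl
    initial (suc zero)          = refl
    initial (suc (suc zero))    = refl
    initial (suc (suc (suc z))) = refl

open CommutativeSemiring using (Carrier; _≈_; _*_)

mainTheorem2 : ∀ {c ℓ} (R : CommutativeSemiring c ℓ) (u : ℕ → Carrier R) (v : Carrier R) (n : ℕ) →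
    _≈_ R (sumR R (map (λ π → _*_ R (monoS R u (DES π)) (pow R v (ides π))) (perms n)))
    (sumR R (map (λ e → _*_ R (monoS R u (ASC e)) (pow R v (row e))) (invTables n)))
mainTheorem2 R u v zero    = CommutativeSemiring.refl R
mainTheorem2 R u v (suc L) = begin
  ∑ permWeight (perms (suc L))                                     ≈⟨ ∑-perms (suc L) permWeight ⟩
  ∑ permWeight Ps                                                  ≈⟨ ∑-cong Ps (λ π → sym (*-identityʳ (permWeight π))) ⟩
  ∑ (λ π → permWeight π ⊛ permGF (ideFlag π) (at π (suc L)) (suc L) 0) Ps       ≈⟨ ∑-permsByInsertion-unfold L 0 ⟩
  permGF (ideFlag [ 1 ]) 1 1 (L + 0)                               ≈⟨ permGF≈tableGF-initial (L + 0) ⟩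
  tableGF (λ y → occurs y [ 1 ]) 1 1 (L + 0)                       ≈⟨ sym (∑-tablesByAppending-unfold L 0) ⟩
  ∑ (λ e → tableWeight e ⊛ tableGF (λ y → occurs y e) (at e (suc L)) (suc L) 0) Es
    ≈⟨ ∑-cong Es (λ e → trans (*-cong ≈-refl (+-identityʳ 1#)) (*-identityʳ (tableWeight e))) ⟩
  ∑ tableWeight Es                                                 ≈⟨ sym (∑-invTables (suc L) tableWeight) ⟩
  ∑ tableWeight (invTables (suc L))                                ∎
  where
  open CommutativeSemiring R hiding (zero; _≈_; Carrier) renaming (_+_ to _⊕_; _*_ to _⊛_; refl to ≈-refl)
  open import Relation.Binary.Reasoning.Setoid setoid
  open Sums R
  open Enumerations R
  open TableGF R u v
  open PermGF R u v
  open Unfolding R u v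
  Ps = permsByInsertion (suc L)
  Es = tablesByAppending (suc L)
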